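{- Let $p_1$ and $p_2$ be two distinct primes. Then $\min\{\deg f(x): f(x)\in\mathcal{A}_{p_1p_2}\}=p_1p_2-1$.
   Context: For a positive integer $n$, $\Phi_n(x)$ denotes the $n$-th cyclotomic polynomial and $\mathcal{A}_n$ is the set of polynomials $f(x)\in\mathbb{Z}[x]$ such that $\Phi_n(x)$ divides $f(x)$ and $f(x)=x^m-a_{m-1}x^{m-1}-\cdots-a_1x-1$ for some integer $m<n$ with $a_i\in\{0,1\}$ for $1\le i<m$. -}

module Defs where

open import Data.Nat as ℕ using (ℕ; zero; suc; _∸_; _≤_; _<_)
open import Data.Nat.Divisibility using (_∣?_)
open import Data.Integer as ℤ using (ℤ; +_; -_)
open import Data.Bool using (Bool; true; false; if_then_else_; _∧_)
open import Data.List using (List; []; _∷_; _++_; [_]; map; foldr; upTo; replicate; length)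
open import Data.Vec as Vec using (Vec)
open import Data.Product using (Σ; Σ-syntax; _×_)
open import Relation.Nullary.Decidable using (⌊_⌋)
open import Relation.Binary.PropositionalEquality using (_≡_)

-- Polynomials in ℤ[x] as coefficient lists, lowest degree first:
-- a₀ ∷ a₁ ∷ … represents a₀ + a₁ x + …  (trailing zeros allowed).

Poly : Set
Poly = List ℤ

coeff : Poly → ℕ → ℤ
coeff []       _       = + 0
coeff (a ∷ f)  zero    = a
coeff (a ∷ f)  (suc i) = coeff f i

_≈ₚ_ : Poly → Poly → Set
f ≈ₚ g = ∀ i → coeff f i ≡ coeff g i

infixl 6 _+ₚ_ _-ₚ_
infixl 7 _*ₚ_

_+ₚ_ : Poly → Poly → Poly
[]      +ₚ g       = g
(a ∷ f) +ₚ []      = a ∷ f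
(a ∷ f) +ₚ (b ∷ g) = (a ℤ.+ b) ∷ (f +ₚ g)

negₚ : Poly → Poly
negₚ = map (-_)

_-ₚ_ : Poly → Poly → Poly
f -ₚ g = f +ₚ negₚ g

_·ₚ_ : ℤ → Poly → Poly
c ·ₚ f = map (c ℤ.*_) f

_*ₚ_ : Poly → Poly → Poly
[]      *ₚ g = []
(a ∷ f) *ₚ g = (a ·ₚ g) +ₚ (+ 0 ∷ (f *ₚ g))

shift : ℕ → Poly → Poly
shift k f = replicate k (+ 0) ++ f

_∣ₚ_ : Poly → Poly → Set
g ∣ₚ f = Σ[ q ∈ Poly ] (f ≈ₚ (g *ₚ q))

-- degree (index of the last nonzero coefficient; deg 0 = 0)
isZeroPoly : Poly → Bool
isZeroPoly []      = true
isZeroPoly (a ∷ f) = ⌊ a ℤ.≟ + 0 ⌋ ∧ isZeroPoly f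

deg : Poly → ℕ
deg []      = 0
deg (a ∷ f) = if isZeroPoly f then 0 else suc (deg f)

xⁿ-1 : ℕ → Poly
xⁿ-1 n = (replicate n (+ 0) ++ [ + 1 ]) -ₚ [ + 1 ]

-- Quotient of f by a monic polynomial g (long division).
-- g is assumed to be given with leading coefficient 1 as its last entry,
-- so deg g = length g ∸ 1.

quotMonic : Poly → Poly → Poly
quotMonic f g = go (length f ∸ d) f
  where
  d : ℕ
  d = length g ∸ 1
  -- go k r computes the quotient coefficients of x^0 … x^(k-1)
  go : ℕ → Poly → Poly
  go zero    r = []
  go (suc k) r = go k (r -ₚ shift k (c ·ₚ g)) ++ [ c ]
    where c = coeff r (k ℕ.+ d)

-- Cyclotomic polynomials, defined recursively by
--   Φ_n(x) = (x^n - 1) / ∏_{d ∣ n, d < n} Φ_d(x).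

properDivProd : ℕ → (ℕ → Poly) → Poly
properDivProd m T =
  foldr (λ d acc → if ⌊ d ∣? m ⌋ then T d *ₚ acc else acc)
        [ + 1 ] (map suc (upTo (m ∸ 1)))

-- cycTab n d = Φ_d for 1 ≤ d ≤ n
cycTab : ℕ → ℕ → Poly
cycTab zero    d = [ + 1 ]
cycTab (suc n) d =
  if ⌊ d ℕ.≟ suc n ⌋
  then quotMonic (xⁿ-1 (suc n)) (properDivProd (suc n) (cycTab n))
  else cycTab n d

Φ : ℕ → Poly
Φ n = cycTab n n

-- The set 𝒜_n.
-- fA m a = x^m - a_{m-1} x^{m-1} - … - a_1 x - 1, where the vector
-- a = (a_1, …, a_{m-1}) has entries in {0,1} (encoded as Bool).

bit : Bool → ℤ
bit true  = + 1
bit false = + 0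

fA : (m : ℕ) → Vec Bool (m ∸ 1) → Poly
fA m a = (- + 1) ∷ (map (λ b → - bit b) (Vec.toList a) ++ [ + 1 ])

In𝒜 : ℕ → Poly → Set
In𝒜 n f = Σ[ m ∈ ℕ ] Σ[ a ∈ Vec Bool (m ∸ 1) ]
  (1 ≤ m × m < n × f ≈ₚ fA m a × Φ n ∣ₚ f)

-- Write n = p q with p < q. Unfolding the recursive definition, Φ n is the
-- quotient of x^n - 1 by Φ 1 Φ p Φ q; from a Bézout relation p a = 1 + b q one
-- writes the exact quotient down explicitly, and obtains
--   (x - 1) (1 + ⋯ + x^(p-1)) (1 + ⋯ + x^(q-1)) Φ n = x^n - 1.
-- Upper bound: x^(q-1) (x^n - 1)/(x^q - 1) + x^(p-1) (x^n - 1)/(x^p - 1) - (x^n - 1)/(x - 1)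
-- is a multiple of Φ n of degree n - 1 whose coefficients are 1 at the top, -1 at
-- the bottom and 0 or -1 in between, since the exponents q t - 1 and p t - 1 only
-- meet at n - 1.
-- Lower bound: pick A = q a, B = p c ≥ 2 with A + B = n + 1. Since (x^q - 1)(x^p - 1)
-- divides (x^A - 1)(x^B - 1), x^n - 1 divides f (x^A - 1)(x^B - 1) for every
-- multiple f of Φ n. If f ∈ 𝒜 n had degree m < n - 1, the coefficient of
-- x^(m+1) in this product reduced modulo x^n - 1 would be 1 minus a sum of
-- nonpositive coefficients of f, hence not 0.

module Submission where

open import Defs
open import Data.Nat as ℕ using (ℕ; zero; suc; _+_; _*_; _∸_; _⊔_; _≤_; _<_; z≤n; s≤s)
import Data.Nat.Properties as ℕP
open import Data.Integer as ℤ using (ℤ; -_; +0; 1ℤ; -1ℤ)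
import Data.Integer.Properties as ℤP
open import Data.Integer.Tactic.RingSolver using (solve-∀)
open import Data.List using (List; []; _∷_; _++_; [_]; map; length; replicate; foldr; applyUpTo)
open import Relation.Binary.PropositionalEquality hiding ([_])
open import Data.Product using (Σ-syntax; _×_; _,_; proj₁; proj₂)
open import Relation.Binary.Bundles using (Setoid)
open import Data.Sum using (_⊎_; inj₁; inj₂)
open import Data.Empty using (⊥; ⊥-elim)
open import Relation.Nullary using (¬_; yes; no)
open import Relation.Binary.Definitions using (tri<; tri≈; tri>)
import Data.List.Properties as ListP
open import Function using (case_of_)
open import Data.Vec as Vec using (Vec)
open import Data.Fin as Fin using (Fin)
import Data.Fin.Properties as FinP
import Data.Vec.Properties as VecP
open import Data.Bool using (Bool; true; false; if_then_else_)
open import Relation.Nullary.Decidable using (⌊_⌋)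
open import Data.Nat.Divisibility using (_∣_; _∣?_; divides; *-cancelˡ-∣; ∣⇒≤)
open import Data.Nat.DivMod using (_%_; _/_; %-congˡ; [m+kn]%n≡m%n; %-distribˡ-*; m%n%n≡m%n; m≡m%n+[m/n]*n; m%n<n)
open import Data.Nat.Primality using (Prime; prime⇒irreducible; prime⇒nonZero)
open import Data.Nat.Coprimality as Coprime using (Coprime; coprime-Bézout; coprime-divisor)
open import Data.Nat.GCD using (module Bézout)
open import Data.Nat.Tactic.RingSolver using () renaming (solve-∀ to solve-∀ℕ)
open import Algebra.Bundles using (CommutativeMonoid)
import Relation.Binary.Reasoning.Setoid
import Algebra.Solver.CommutativeMonoid

-- _≈ₚ_ wrapped in a record, so that both sides can be inferred from a proof.
infix 4 _≈_
record _≈_ (f g : Poly) : Set where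
  constructor mk≈
  field at : ∀ i → coeff f i ≡ coeff g i
open _≈_ public

-- Polynomial arithmetic up to coefficientwise equality

≈-refl : ∀ {f} → f ≈ f
≈-refl = mk≈ λ _ → refl

≈-sym : ∀ {f g} → f ≈ g → g ≈ f
≈-sym e = mk≈ λ i → sym (at e i)

≈-trans : ∀ {f g h} → f ≈ g → g ≈ h → f ≈ h
≈-trans e e′ = mk≈ λ i → trans (at e i) (at e′ i)

≈-reflexive : ∀ {f g} → f ≡ g → f ≈ g
≈-reflexive refl = ≈-refl

≈-setoid : Setoid _ _
≈-setoid = record
  { Carrier = Poly ; _≈_ = _≈_
  ; isEquivalence = record { refl = ≈-refl ; sym = ≈-sym ; trans = ≈-trans } }

module ≈-Reasoning = Relation.Binary.Reasoning.Setoid ≈-setoid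

coeff-+ₚ : ∀ f g i → coeff (f +ₚ g) i ≡ coeff f i ℤ.+ coeff g i
coeff-+ₚ []      g       i       = sym (ℤP.+-identityˡ _)
coeff-+ₚ (a ∷ f) []      i       = sym (ℤP.+-identityʳ _)
coeff-+ₚ (a ∷ f) (b ∷ g) zero    = refl
coeff-+ₚ (a ∷ f) (b ∷ g) (suc i) = coeff-+ₚ f g i

coeff-map : ∀ (h : ℤ → ℤ) → h +0 ≡ +0 → ∀ f i → coeff (map h f) i ≡ h (coeff f i)
coeff-map h h0 []      i       = sym h0
coeff-map h h0 (a ∷ f) zero    = refl
coeff-map h h0 (a ∷ f) (suc i) = coeff-map h h0 f i

coeff-negₚ : ∀ f i → coeff (negₚ f) i ≡ - coeff f i
coeff-negₚ = coeff-map -_ refl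

coeff-·ₚ : ∀ c f i → coeff (c ·ₚ f) i ≡ c ℤ.* coeff f i
coeff-·ₚ c = coeff-map (c ℤ.*_) (ℤP.*-zeroʳ c)

coeff--ₚ : ∀ f g i → coeff (f -ₚ g) i ≡ coeff f i ℤ.- coeff g i
coeff--ₚ f g i = trans (coeff-+ₚ f (negₚ g) i) (cong (λ y → coeff f i ℤ.+ y) (coeff-negₚ g i))

coeff-shift-< : ∀ k f {i} → i < k → coeff (shift k f) i ≡ +0
coeff-shift-< (suc k) f {zero}  _         = refl
coeff-shift-< (suc k) f {suc i} (s≤s i<k) = coeff-shift-< k f i<k

coeff-shift-+ : ∀ k f i → coeff (shift k f) (k + i) ≡ coeff f i
coeff-shift-+ zero    f i = refl
coeff-shift-+ (suc k) f i = coeff-shift-+ k f i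

+ₚ-cong : ∀ {f f′ g g′} → f ≈ f′ → g ≈ g′ → f +ₚ g ≈ f′ +ₚ g′
+ₚ-cong {f} {f′} {g} {g′} e e′ = mk≈ λ i →
  trans (coeff-+ₚ f g i) (trans (cong₂ ℤ._+_ (at e i) (at e′ i)) (sym (coeff-+ₚ f′ g′ i)))

+ₚ-congˡ : ∀ {f f′} g → f ≈ f′ → f +ₚ g ≈ f′ +ₚ g
+ₚ-congˡ g e = +ₚ-cong e (≈-refl {g})

+ₚ-congʳ : ∀ f {g g′} → g ≈ g′ → f +ₚ g ≈ f +ₚ g′
+ₚ-congʳ f = +ₚ-cong (≈-refl {f})

negₚ-cong : ∀ {f f′} → f ≈ f′ → negₚ f ≈ negₚ f′
negₚ-cong {f} {f′} e = mk≈ λ i →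
  trans (coeff-negₚ f i) (trans (cong -_ (at e i)) (sym (coeff-negₚ f′ i)))

-ₚ-cong : ∀ {f f′ g g′} → f ≈ f′ → g ≈ g′ → f -ₚ g ≈ f′ -ₚ g′
-ₚ-cong e e′ = +ₚ-cong e (negₚ-cong e′)

·ₚ-cong : ∀ c {f f′} → f ≈ f′ → c ·ₚ f ≈ c ·ₚ f′
·ₚ-cong c {f} {f′} e = mk≈ λ i →
  trans (coeff-·ₚ c f i) (trans (cong (c ℤ.*_) (at e i)) (sym (coeff-·ₚ c f′ i)))

∷-cong : ∀ {a b f g} → a ≡ b → f ≈ g → a ∷ f ≈ b ∷ g
∷-cong a≡b e = mk≈ λ { zero → a≡b ; (suc i) → at e i }

∷-injectiveʳ : ∀ {a b f g} → a ∷ f ≈ b ∷ g → f ≈ g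
∷-injectiveʳ e = mk≈ λ i → at e (suc i)

shift-cong : ∀ k {f g} → f ≈ g → shift k f ≈ shift k g
shift-cong zero    e = e
shift-cong (suc k) e = ∷-cong refl (shift-cong k e)

*ₚ-zeroˡ : ∀ {f} g → f ≈ [] → f *ₚ g ≈ []
*ₚ-zeroˡ {[]}    g e = ≈-refl
*ₚ-zeroˡ {a ∷ f} g e = mk≈ λ i →
  trans (coeff-+ₚ (a ·ₚ g) (+0 ∷ (f *ₚ g)) i)
        (cong₂ ℤ._+_ (trans (coeff-·ₚ a g i) (cong (ℤ._* coeff g i) (at e zero))) (tail i))
  where
  tail : ∀ i → coeff (+0 ∷ (f *ₚ g)) i ≡ +0
  tail zero    = refl
  tail (suc i) = at (*ₚ-zeroˡ {f} g (mk≈ λ j → at e (suc j))) i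

*ₚ-congˡ : ∀ {f f′} g → f ≈ f′ → f *ₚ g ≈ f′ *ₚ g
*ₚ-congˡ {[]}    {f′}      g e = ≈-sym (*ₚ-zeroˡ g (≈-sym e))
*ₚ-congˡ {a ∷ f} {[]}      g e = *ₚ-zeroˡ g e
*ₚ-congˡ {a ∷ f} {a′ ∷ f′} g e =
  +ₚ-cong (≈-reflexive (cong (_·ₚ g) (at e zero))) (∷-cong refl (*ₚ-congˡ g (∷-injectiveʳ e)))

*ₚ-congʳ : ∀ f {g g′} → g ≈ g′ → f *ₚ g ≈ f *ₚ g′
*ₚ-congʳ []      e = ≈-refl
*ₚ-congʳ (a ∷ f) e = +ₚ-cong (·ₚ-cong a e) (∷-cong refl (*ₚ-congʳ f e))

*ₚ-cong : ∀ {f f′ g g′} → f ≈ f′ → g ≈ g′ → f *ₚ g ≈ f′ *ₚ g′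
*ₚ-cong {f′ = f′} {g} e e′ = ≈-trans (*ₚ-congˡ g e) (*ₚ-congʳ f′ e′)

+ₚ-comm : ∀ f g → f +ₚ g ≈ g +ₚ f
+ₚ-comm f g = mk≈ λ i →
  trans (coeff-+ₚ f g i) (trans (ℤP.+-comm (coeff f i) (coeff g i)) (sym (coeff-+ₚ g f i)))

+ₚ-assoc : ∀ f g h → (f +ₚ g) +ₚ h ≈ f +ₚ (g +ₚ h)
+ₚ-assoc f g h = mk≈ λ i → let open ≡-Reasoning in begin
  coeff ((f +ₚ g) +ₚ h) i                 ≡⟨ coeff-+ₚ (f +ₚ g) h i ⟩
  coeff (f +ₚ g) i ℤ.+ coeff h i          ≡⟨ cong (ℤ._+ coeff h i) (coeff-+ₚ f g i) ⟩
  coeff f i ℤ.+ coeff g i ℤ.+ coeff h i   ≡⟨ ℤP.+-assoc (coeff f i) (coeff g i) (coeff h i) ⟩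
  coeff f i ℤ.+ (coeff g i ℤ.+ coeff h i) ≡⟨ cong (λ y → coeff f i ℤ.+ y) (coeff-+ₚ g h i) ⟨
  coeff f i ℤ.+ coeff (g +ₚ h) i          ≡⟨ coeff-+ₚ f (g +ₚ h) i ⟨
  coeff (f +ₚ (g +ₚ h)) i                 ∎

+ₚ-identityʳ : ∀ f → f +ₚ [] ≈ f
+ₚ-identityʳ f = mk≈ λ i → trans (coeff-+ₚ f [] i) (ℤP.+-identityʳ _)

-ₚ-inverseʳ : ∀ f → f -ₚ f ≈ []
-ₚ-inverseʳ f = mk≈ λ i → trans (coeff--ₚ f f i) (ℤP.+-inverseʳ (coeff f i))

-ₚ-+ₚ-cancel : ∀ f g → (f -ₚ g) +ₚ g ≈ f
-ₚ-+ₚ-cancel f g = mk≈ λ i →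
  trans (coeff-+ₚ (f -ₚ g) g i) (trans (cong (ℤ._+ coeff g i) (coeff--ₚ f g i)) (cancel (coeff f i) (coeff g i)))
  where
  cancel : ∀ a b → a ℤ.- b ℤ.+ b ≡ a
  cancel = solve-∀

-ₚ-telescope : ∀ f g h → (g -ₚ f) +ₚ (h -ₚ g) ≈ h -ₚ f
-ₚ-telescope f g h = mk≈ λ i → trans (coeff-+ₚ (g -ₚ f) (h -ₚ g) i)
  (trans (cong₂ ℤ._+_ (coeff--ₚ g f i) (coeff--ₚ h g i)) (trans (telescope (coeff f i) (coeff g i) (coeff h i)) (sym (coeff--ₚ h f i))))
  where
  telescope : ∀ a b c → (b ℤ.- a) ℤ.+ (c ℤ.- b) ≡ c ℤ.- a
  telescope = solve-∀

-ₚ--ₚ-cancelˡ : ∀ f g h → (h -ₚ f) -ₚ (h -ₚ g) ≈ g -ₚ f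
-ₚ--ₚ-cancelˡ f g h = mk≈ λ i → trans (coeff--ₚ (h -ₚ f) (h -ₚ g) i)
  (trans (cong₂ ℤ._-_ (coeff--ₚ h f i) (coeff--ₚ h g i)) (trans (cancel (coeff f i) (coeff g i) (coeff h i)) (sym (coeff--ₚ g f i))))
  where
  cancel : ∀ a b c → (c ℤ.- a) ℤ.- (c ℤ.- b) ≡ b ℤ.- a
  cancel = solve-∀

·ₚ-distrib-+ₚ : ∀ c f g → c ·ₚ (f +ₚ g) ≈ c ·ₚ f +ₚ c ·ₚ g
·ₚ-distrib-+ₚ c f g = mk≈ λ i → let open ≡-Reasoning in begin
  coeff (c ·ₚ (f +ₚ g)) i                    ≡⟨ coeff-·ₚ c (f +ₚ g) i ⟩
  c ℤ.* coeff (f +ₚ g) i                     ≡⟨ cong (c ℤ.*_) (coeff-+ₚ f g i) ⟩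
  c ℤ.* (coeff f i ℤ.+ coeff g i)            ≡⟨ ℤP.*-distribˡ-+ c (coeff f i) (coeff g i) ⟩
  c ℤ.* coeff f i ℤ.+ c ℤ.* coeff g i        ≡⟨ cong₂ ℤ._+_ (coeff-·ₚ c f i) (coeff-·ₚ c g i) ⟨
  coeff (c ·ₚ f) i ℤ.+ coeff (c ·ₚ g) i      ≡⟨ coeff-+ₚ (c ·ₚ f) (c ·ₚ g) i ⟨
  coeff (c ·ₚ f +ₚ c ·ₚ g) i                 ∎

·ₚ-identityˡ : ∀ f → 1ℤ ·ₚ f ≈ f
·ₚ-identityˡ f = mk≈ λ i → trans (coeff-·ₚ 1ℤ f i) (ℤP.*-identityˡ _)

-1·ₚ≈negₚ : ∀ f → -1ℤ ·ₚ f ≈ negₚ f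
-1·ₚ≈negₚ f = mk≈ λ i → trans (coeff-·ₚ -1ℤ f i) (trans (ℤP.-1*i≡-i _) (sym (coeff-negₚ f i)))

0∷-*ₚ : ∀ f g → (+0 ∷ f) *ₚ g ≈ +0 ∷ (f *ₚ g)
0∷-*ₚ f g = mk≈ λ i →
  trans (coeff-+ₚ (+0 ·ₚ g) (+0 ∷ (f *ₚ g)) i)
        (trans (cong (ℤ._+ coeff (+0 ∷ (f *ₚ g)) i) (coeff-·ₚ +0 g i)) (ℤP.+-identityˡ _))

*ₚ-zeroʳ : ∀ f → f *ₚ [] ≈ []
*ₚ-zeroʳ []      = ≈-refl
*ₚ-zeroʳ (a ∷ f) = mk≈ λ { zero → refl ; (suc i) → at (*ₚ-zeroʳ f) i }

coeff-∷-*ₚ : ∀ c f g i → coeff ((c ∷ f) *ₚ g) i ≡ c ℤ.* coeff g i ℤ.+ coeff (+0 ∷ (f *ₚ g)) i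
coeff-∷-*ₚ c f g i =
  trans (coeff-+ₚ (c ·ₚ g) (+0 ∷ (f *ₚ g)) i) (cong (ℤ._+ coeff (+0 ∷ (f *ₚ g)) i) (coeff-·ₚ c g i))

*ₚ-distribʳ-+ₚ : ∀ f g h → (f +ₚ g) *ₚ h ≈ f *ₚ h +ₚ g *ₚ h
*ₚ-distribʳ-+ₚ []      g       h = ≈-refl
*ₚ-distribʳ-+ₚ (a ∷ f) []      h = ≈-sym (+ₚ-identityʳ _)
*ₚ-distribʳ-+ₚ (a ∷ f) (b ∷ g) h = mk≈ λ i → let open ≡-Reasoning in begin
  coeff (((a ℤ.+ b) ∷ (f +ₚ g)) *ₚ h) i
    ≡⟨ coeff-∷-*ₚ (a ℤ.+ b) (f +ₚ g) h i ⟩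
  (a ℤ.+ b) ℤ.* coeff h i ℤ.+ coeff (+0 ∷ ((f +ₚ g) *ₚ h)) i
    ≡⟨ cong (λ y → (a ℤ.+ b) ℤ.* coeff h i ℤ.+ y) (tail i) ⟩
  (a ℤ.+ b) ℤ.* coeff h i ℤ.+ (coeff (+0 ∷ (f *ₚ h)) i ℤ.+ coeff (+0 ∷ (g *ₚ h)) i)
    ≡⟨ regroup a b (coeff h i) _ _ ⟩
  (a ℤ.* coeff h i ℤ.+ coeff (+0 ∷ (f *ₚ h)) i) ℤ.+ (b ℤ.* coeff h i ℤ.+ coeff (+0 ∷ (g *ₚ h)) i)
    ≡⟨ cong₂ ℤ._+_ (coeff-∷-*ₚ a f h i) (coeff-∷-*ₚ b g h i) ⟨
  coeff ((a ∷ f) *ₚ h) i ℤ.+ coeff ((b ∷ g) *ₚ h) i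
    ≡⟨ coeff-+ₚ ((a ∷ f) *ₚ h) ((b ∷ g) *ₚ h) i ⟨
  coeff ((a ∷ f) *ₚ h +ₚ (b ∷ g) *ₚ h) i ∎
  where
  regroup : ∀ a b c y z → (a ℤ.+ b) ℤ.* c ℤ.+ (y ℤ.+ z) ≡ (a ℤ.* c ℤ.+ y) ℤ.+ (b ℤ.* c ℤ.+ z)
  regroup = solve-∀
  tail : ∀ i → coeff (+0 ∷ ((f +ₚ g) *ₚ h)) i ≡ coeff (+0 ∷ (f *ₚ h)) i ℤ.+ coeff (+0 ∷ (g *ₚ h)) i
  tail zero    = refl
  tail (suc i) = trans (at (*ₚ-distribʳ-+ₚ f g h) i) (coeff-+ₚ (f *ₚ h) (g *ₚ h) i)

·ₚ-*ₚ-assoc : ∀ c f g → (c ·ₚ f) *ₚ g ≈ c ·ₚ (f *ₚ g)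
·ₚ-*ₚ-assoc c []      g = ≈-refl
·ₚ-*ₚ-assoc c (a ∷ f) g = begin
  (c ℤ.* a) ·ₚ g +ₚ (+0 ∷ ((c ·ₚ f) *ₚ g))   ≈⟨ +ₚ-cong scalars (∷-cong (sym (ℤP.*-zeroʳ c)) (·ₚ-*ₚ-assoc c f g)) ⟩
  c ·ₚ (a ·ₚ g) +ₚ c ·ₚ (+0 ∷ (f *ₚ g))      ≈⟨ ·ₚ-distrib-+ₚ c (a ·ₚ g) (+0 ∷ (f *ₚ g)) ⟨
  c ·ₚ (a ·ₚ g +ₚ (+0 ∷ (f *ₚ g)))           ∎
  where
  open ≈-Reasoning
  scalars : (c ℤ.* a) ·ₚ g ≈ c ·ₚ (a ·ₚ g)
  scalars = mk≈ λ i → trans (coeff-·ₚ (c ℤ.* a) g i)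
    (trans (ℤP.*-assoc c a (coeff g i)) (sym (trans (coeff-·ₚ c (a ·ₚ g) i) (cong (c ℤ.*_) (coeff-·ₚ a g i)))))

*ₚ-·ₚ-comm : ∀ c f g → f *ₚ (c ·ₚ g) ≈ c ·ₚ (f *ₚ g)
*ₚ-·ₚ-comm c []      g = ≈-refl
*ₚ-·ₚ-comm c (a ∷ f) g = begin
  a ·ₚ (c ·ₚ g) +ₚ (+0 ∷ (f *ₚ (c ·ₚ g)))    ≈⟨ +ₚ-cong scalars (∷-cong (sym (ℤP.*-zeroʳ c)) (*ₚ-·ₚ-comm c f g)) ⟩
  c ·ₚ (a ·ₚ g) +ₚ c ·ₚ (+0 ∷ (f *ₚ g))      ≈⟨ ·ₚ-distrib-+ₚ c (a ·ₚ g) (+0 ∷ (f *ₚ g)) ⟨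
  c ·ₚ (a ·ₚ g +ₚ (+0 ∷ (f *ₚ g)))           ∎
  where
  open ≈-Reasoning
  swap : ∀ a c x → a ℤ.* (c ℤ.* x) ≡ c ℤ.* (a ℤ.* x)
  swap = solve-∀
  scalars : a ·ₚ (c ·ₚ g) ≈ c ·ₚ (a ·ₚ g)
  scalars = mk≈ λ i → trans (coeff-·ₚ a (c ·ₚ g) i) (trans (cong (a ℤ.*_) (coeff-·ₚ c g i))
    (trans (swap a c (coeff g i)) (sym (trans (coeff-·ₚ c (a ·ₚ g) i) (cong (c ℤ.*_) (coeff-·ₚ a g i))))))

*ₚ-∷ʳ : ∀ f b g → f *ₚ (b ∷ g) ≈ b ·ₚ f +ₚ (+0 ∷ (f *ₚ g))
*ₚ-∷ʳ []      b g = mk≈ λ { zero → refl ; (suc i) → refl }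
*ₚ-∷ʳ (a ∷ f) b g = ∷-cong (cong (ℤ._+ +0) (ℤP.*-comm a b)) (begin
  a ·ₚ g +ₚ f *ₚ (b ∷ g)                   ≈⟨ +ₚ-congʳ (a ·ₚ g) (*ₚ-∷ʳ f b g) ⟩
  a ·ₚ g +ₚ (b ·ₚ f +ₚ (+0 ∷ (f *ₚ g)))    ≈⟨ +ₚ-assoc (a ·ₚ g) (b ·ₚ f) _ ⟨
  (a ·ₚ g +ₚ b ·ₚ f) +ₚ (+0 ∷ (f *ₚ g))    ≈⟨ +ₚ-congˡ _ (+ₚ-comm (a ·ₚ g) (b ·ₚ f)) ⟩
  (b ·ₚ f +ₚ a ·ₚ g) +ₚ (+0 ∷ (f *ₚ g))    ≈⟨ +ₚ-assoc (b ·ₚ f) (a ·ₚ g) _ ⟩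
  b ·ₚ f +ₚ (a ·ₚ g +ₚ (+0 ∷ (f *ₚ g)))    ∎)
  where open ≈-Reasoning

*ₚ-comm : ∀ f g → f *ₚ g ≈ g *ₚ f
*ₚ-comm []      g = ≈-sym (*ₚ-zeroʳ g)
*ₚ-comm (a ∷ f) g = ≈-trans (+ₚ-congʳ (a ·ₚ g) (∷-cong refl (*ₚ-comm f g))) (≈-sym (*ₚ-∷ʳ g a f))

*ₚ-assoc : ∀ f g h → (f *ₚ g) *ₚ h ≈ f *ₚ (g *ₚ h)
*ₚ-assoc []      g h = ≈-refl
*ₚ-assoc (a ∷ f) g h = begin
  (a ·ₚ g +ₚ (+0 ∷ (f *ₚ g))) *ₚ h           ≈⟨ *ₚ-distribʳ-+ₚ (a ·ₚ g) _ h ⟩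
  (a ·ₚ g) *ₚ h +ₚ (+0 ∷ (f *ₚ g)) *ₚ h      ≈⟨ +ₚ-cong (·ₚ-*ₚ-assoc a g h) (0∷-*ₚ (f *ₚ g) h) ⟩
  a ·ₚ (g *ₚ h) +ₚ (+0 ∷ ((f *ₚ g) *ₚ h))    ≈⟨ +ₚ-congʳ _ (∷-cong refl (*ₚ-assoc f g h)) ⟩
  a ·ₚ (g *ₚ h) +ₚ (+0 ∷ (f *ₚ (g *ₚ h)))    ∎
  where open ≈-Reasoning

*ₚ-distribˡ-+ₚ : ∀ f g h → f *ₚ (g +ₚ h) ≈ f *ₚ g +ₚ f *ₚ h
*ₚ-distribˡ-+ₚ f g h = begin
  f *ₚ (g +ₚ h)      ≈⟨ *ₚ-comm f (g +ₚ h) ⟩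
  (g +ₚ h) *ₚ f      ≈⟨ *ₚ-distribʳ-+ₚ g h f ⟩
  g *ₚ f +ₚ h *ₚ f   ≈⟨ +ₚ-cong (*ₚ-comm g f) (*ₚ-comm h f) ⟩
  f *ₚ g +ₚ f *ₚ h   ∎
  where open ≈-Reasoning

*ₚ-negₚʳ : ∀ f g → f *ₚ negₚ g ≈ negₚ (f *ₚ g)
*ₚ-negₚʳ f g = begin
  f *ₚ negₚ g             ≈⟨ *ₚ-congʳ f (-1·ₚ≈negₚ g) ⟨
  f *ₚ (-1ℤ ·ₚ g)     ≈⟨ *ₚ-·ₚ-comm -1ℤ f g ⟩
  -1ℤ ·ₚ (f *ₚ g)     ≈⟨ -1·ₚ≈negₚ _ ⟩
  negₚ (f *ₚ g)           ∎
  where open ≈-Reasoning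

*ₚ-distribˡ--ₚ : ∀ f g h → f *ₚ (g -ₚ h) ≈ f *ₚ g -ₚ f *ₚ h
*ₚ-distribˡ--ₚ f g h = ≈-trans (*ₚ-distribˡ-+ₚ f g (negₚ h)) (+ₚ-congʳ (f *ₚ g) (*ₚ-negₚʳ f h))

*ₚ-distribʳ--ₚ : ∀ f g h → (f -ₚ g) *ₚ h ≈ f *ₚ h -ₚ g *ₚ h
*ₚ-distribʳ--ₚ f g h = begin
  (f -ₚ g) *ₚ h          ≈⟨ *ₚ-comm (f -ₚ g) h ⟩
  h *ₚ (f -ₚ g)          ≈⟨ *ₚ-distribˡ--ₚ h f g ⟩
  h *ₚ f -ₚ h *ₚ g       ≈⟨ -ₚ-cong (*ₚ-comm h f) (*ₚ-comm h g) ⟩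
  f *ₚ h -ₚ g *ₚ h       ∎
  where open ≈-Reasoning

*ₚ-identityˡ : ∀ f → [ 1ℤ ] *ₚ f ≈ f
*ₚ-identityˡ f = ≈-trans (+ₚ-cong (·ₚ-identityˡ f) (mk≈ λ { zero → refl ; (suc i) → refl })) (+ₚ-identityʳ f)

*ₚ-identityʳ : ∀ f → f *ₚ [ 1ℤ ] ≈ f
*ₚ-identityʳ f = ≈-trans (*ₚ-comm f _) (*ₚ-identityˡ f)

*ₚ-[c] : ∀ f c → f *ₚ [ c ] ≈ c ·ₚ f
*ₚ-[c] f c = begin
  f *ₚ [ c ]              ≈⟨ *ₚ-congʳ f (∷-cong (sym (ℤP.*-identityʳ c)) ≈-refl) ⟩
  f *ₚ (c ·ₚ [ 1ℤ ])     ≈⟨ *ₚ-·ₚ-comm c f [ 1ℤ ] ⟩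
  c ·ₚ (f *ₚ [ 1ℤ ])     ≈⟨ ·ₚ-cong c (*ₚ-identityʳ f) ⟩
  c ·ₚ f                  ∎
  where open ≈-Reasoning

*ₚ-commutativeMonoid : CommutativeMonoid _ _
*ₚ-commutativeMonoid = record
  { Carrier = Poly ; _≈_ = _≈_ ; _∙_ = _*ₚ_ ; ε = [ 1ℤ ]
  ; isCommutativeMonoid = record
    { isMonoid = record
      { isSemigroup = record
        { isMagma = record { isEquivalence = Setoid.isEquivalence ≈-setoid ; ∙-cong = *ₚ-cong }
        ; assoc = *ₚ-assoc }
      ; identity = *ₚ-identityˡ , *ₚ-identityʳ }
    ; comm = *ₚ-comm } }

open Algebra.Solver.CommutativeMonoid *ₚ-commutativeMonoid using (solve; _⊕_; _⊜_)

-- Shifts and monomials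

shift-*ₚˡ : ∀ k f g → shift k f *ₚ g ≈ shift k (f *ₚ g)
shift-*ₚˡ zero    f g = ≈-refl
shift-*ₚˡ (suc k) f g = ≈-trans (0∷-*ₚ (shift k f) g) (∷-cong refl (shift-*ₚˡ k f g))

shift-*ₚʳ : ∀ k f g → f *ₚ shift k g ≈ shift k (f *ₚ g)
shift-*ₚʳ k f g = ≈-trans (*ₚ-comm f (shift k g)) (≈-trans (shift-*ₚˡ k g f) (shift-cong k (*ₚ-comm g f)))

shift-+ₚ : ∀ k f g → shift k (f +ₚ g) ≈ shift k f +ₚ shift k g
shift-+ₚ zero    f g = ≈-refl
shift-+ₚ (suc k) f g = ∷-cong refl (shift-+ₚ k f g)

shift-negₚ : ∀ k f → shift k (negₚ f) ≈ negₚ (shift k f)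
shift-negₚ zero    f = ≈-refl
shift-negₚ (suc k) f = ∷-cong refl (shift-negₚ k f)

shift--ₚ : ∀ k f g → shift k (f -ₚ g) ≈ shift k f -ₚ shift k g
shift--ₚ k f g = ≈-trans (shift-+ₚ k f (negₚ g)) (+ₚ-congʳ (shift k f) (shift-negₚ k g))

shift-shift : ∀ a b f → shift a (shift b f) ≡ shift (a + b) f
shift-shift zero    b f = refl
shift-shift (suc a) b f = cong (+0 ∷_) (shift-shift a b f)

x^ : ℕ → Poly
x^ k = shift k [ 1ℤ ]

*ₚ-x^ : ∀ f k → f *ₚ x^ k ≈ shift k f
*ₚ-x^ f k = ≈-trans (shift-*ₚʳ k f [ 1ℤ ]) (shift-cong k (*ₚ-identityʳ f))

*ₚ-xⁿ-1 : ∀ f k → f *ₚ xⁿ-1 k ≈ shift k f -ₚ f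
*ₚ-xⁿ-1 f k = ≈-trans (*ₚ-distribˡ--ₚ f (x^ k) [ 1ℤ ]) (-ₚ-cong (*ₚ-x^ f k) (*ₚ-identityʳ f))

coeff-x^-≢ : ∀ k {i} → i ≢ k → coeff (x^ k) i ≡ +0
coeff-x^-≢ zero    {zero}        i≢k = ⊥-elim (i≢k refl)
coeff-x^-≢ zero    {suc zero}    _   = refl
coeff-x^-≢ zero    {suc (suc i)} _   = refl
coeff-x^-≢ (suc k) {zero}        _   = refl
coeff-x^-≢ (suc k) {suc i}       i≢k = coeff-x^-≢ k (λ i≡k → i≢k (cong suc i≡k))

coeff-shift-[c] : ∀ k c → coeff (shift k [ c ]) k ≡ c
coeff-shift-[c] zero    c = refl
coeff-shift-[c] (suc k) c = coeff-shift-[c] k c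

coeff-++-< : ∀ f g {i} → i < length f → coeff (f ++ g) i ≡ coeff f i
coeff-++-< (a ∷ f) g {zero}  _         = refl
coeff-++-< (a ∷ f) g {suc i} (s≤s i<n) = coeff-++-< f g i<n

coeff-++-+ : ∀ f g i → coeff (f ++ g) (length f + i) ≡ coeff g i
coeff-++-+ []      g i = refl
coeff-++-+ (a ∷ f) g i = coeff-++-+ f g i

++-[c] : ∀ f c → f ++ [ c ] ≈ f +ₚ shift (length f) [ c ]
++-[c] []      c = ≈-refl
++-[c] (a ∷ f) c = ∷-cong (sym (ℤP.+-identityʳ a)) (++-[c] f c)

coeff-≥length : ∀ f {i} → length f ≤ i → coeff f i ≡ +0
coeff-≥length []      _         = refl
coeff-≥length (a ∷ f) {suc i} (s≤s n≤i) = coeff-≥length f n≤i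

length-+ₚ : ∀ f g → length (f +ₚ g) ≡ length f ⊔ length g
length-+ₚ []      g       = refl
length-+ₚ (a ∷ f) []      = refl
length-+ₚ (a ∷ f) (b ∷ g) = cong suc (length-+ₚ f g)

length-*ₚ : ∀ a b f g → length f ≡ suc a → length g ≡ suc b → length (f *ₚ g) ≡ suc (a + b)
length-*ₚ zero    b (c ∷ [])     g _  lg = begin
  length (c ·ₚ g +ₚ [ +0 ])             ≡⟨ length-+ₚ (c ·ₚ g) [ +0 ] ⟩
  length (c ·ₚ g) ⊔ 1                   ≡⟨ cong (_⊔ 1) (trans (ListP.length-map (c ℤ.*_) g) lg) ⟩
  suc b ⊔ 1                             ≡⟨ ℕP.m≥n⇒m⊔n≡m (s≤s z≤n) ⟩
  suc b                                 ∎
  where open ≡-Reasoning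
length-*ₚ (suc a) b (c ∷ d ∷ f) g lf lg = begin
  length (c ·ₚ g +ₚ (+0 ∷ ((d ∷ f) *ₚ g)))      ≡⟨ length-+ₚ (c ·ₚ g) (+0 ∷ ((d ∷ f) *ₚ g)) ⟩
  length (c ·ₚ g) ⊔ suc (length ((d ∷ f) *ₚ g)) ≡⟨ cong₂ _⊔_ (trans (ListP.length-map (c ℤ.*_) g) lg)
                                                     (cong suc (length-*ₚ a b (d ∷ f) g (ℕP.suc-injective lf) lg)) ⟩
  suc b ⊔ suc (suc (a + b))                     ≡⟨ ℕP.m≤n⇒m⊔n≡n (s≤s (ℕP.m≤n+m b (suc a))) ⟩
  suc (suc a + b)                               ∎
  where open ≡-Reasoning

-- Degree bounds and exact division by monic polynomials

record DegreeBelow (k : ℕ) (f : Poly) : Set where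
  constructor mkDegreeBelow
  field vanish : ∀ i → k ≤ i → coeff f i ≡ +0
open DegreeBelow public

degreeBelow-length : ∀ f → DegreeBelow (length f) f
degreeBelow-length f = mkDegreeBelow λ _ → coeff-≥length f

degreeBelow-cong : ∀ {k f g} → f ≈ g → DegreeBelow k f → DegreeBelow k g
degreeBelow-cong e d = mkDegreeBelow λ i k≤i → trans (sym (at e i)) (vanish d i k≤i)

degreeBelow-mono : ∀ {k k′ f} → k ≤ k′ → DegreeBelow k f → DegreeBelow k′ f
degreeBelow-mono k≤k′ d = mkDegreeBelow λ i k′≤i → vanish d i (ℕP.≤-trans k≤k′ k′≤i)

degreeBelow-0 : ∀ {f} → DegreeBelow 0 f → f ≈ []
degreeBelow-0 d = mk≈ λ i → vanish d i z≤n

degreeBelow-tail : ∀ {k a f} → DegreeBelow (suc k) (a ∷ f) → DegreeBelow k f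
degreeBelow-tail d = mkDegreeBelow λ i k≤i → vanish d (suc i) (s≤s k≤i)

degreeBelow-pred : ∀ {k f} → DegreeBelow (suc k) f → coeff f k ≡ +0 → DegreeBelow k f
degreeBelow-pred {k} d fₖ≡0 = mkDegreeBelow λ i k≤i → case ℕP.m≤n⇒m<n∨m≡n k≤i of λ where
  (inj₁ k<i)  → vanish d i k<i
  (inj₂ refl) → fₖ≡0

degreeBelow-shift : ∀ {k f} m → DegreeBelow k f → DegreeBelow (m + k) (shift m f)
degreeBelow-shift {k} {f} m d = mkDegreeBelow λ i m+k≤i →
  case ℕP.m≤n⇒∃[o]m+o≡n (ℕP.≤-trans (ℕP.m≤m+n m k) m+k≤i) of λ where
    (j , refl) → trans (coeff-shift-+ m f j) (vanish d j (ℕP.+-cancelˡ-≤ m k j m+k≤i))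

degreeBelow--ₚ : ∀ {k f g} → DegreeBelow k f → DegreeBelow k g → DegreeBelow k (f -ₚ g)
degreeBelow--ₚ {f = f} {g} df dg = mkDegreeBelow λ i k≤i →
  trans (coeff--ₚ f g i) (cong₂ ℤ._-_ (vanish df i k≤i) (vanish dg i k≤i))

degreeBelow-shift-[c] : ∀ k c → DegreeBelow (suc k) (shift k [ c ])
degreeBelow-shift-[c] k c =
  subst (λ m → DegreeBelow m (shift k [ c ])) (ℕP.+-comm k 1) (degreeBelow-shift k (degreeBelow-length [ c ]))

*ₚ-leading : ∀ a b f g → DegreeBelow (suc a) f → DegreeBelow (suc b) g →
         DegreeBelow (suc (a + b)) (f *ₚ g) × coeff (f *ₚ g) (a + b) ≡ coeff f a ℤ.* coeff g b
*ₚ-leading a       b []      g df dg = mkDegreeBelow (λ _ _ → refl) , sym (ℤP.*-zeroˡ (coeff g b))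
*ₚ-leading zero    b (c ∷ f) g df dg = mkDegreeBelow vanishing , scaled b
  where
  scaled : ∀ i → coeff ((c ∷ f) *ₚ g) i ≡ c ℤ.* coeff g i
  scaled i = trans (coeff-∷-*ₚ c f g i) (trans (cong (λ y → c ℤ.* coeff g i ℤ.+ y) (tail i)) (ℤP.+-identityʳ _))
    where
    tail : ∀ i → coeff (+0 ∷ (f *ₚ g)) i ≡ +0
    tail zero    = refl
    tail (suc i) = at (*ₚ-zeroˡ g (degreeBelow-0 (degreeBelow-tail df))) i
  vanishing : ∀ i → suc b ≤ i → coeff ((c ∷ f) *ₚ g) i ≡ +0
  vanishing i b<i = trans (scaled i) (trans (cong (c ℤ.*_) (vanish dg i b<i)) (ℤP.*-zeroʳ c))
*ₚ-leading (suc a) b (c ∷ f) g df dg = mkDegreeBelow vanishing , top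
  where
  ih = *ₚ-leading a b f g (degreeBelow-tail df) dg
  c·g-vanishes : ∀ i → b < suc i → c ℤ.* coeff g (suc i) ≡ +0
  c·g-vanishes i b<1+i = trans (cong (c ℤ.*_) (vanish dg (suc i) b<1+i)) (ℤP.*-zeroʳ c)
  vanishing : ∀ i → suc (suc a + b) ≤ i → coeff ((c ∷ f) *ₚ g) i ≡ +0
  vanishing (suc i) (s≤s a+b<i) = trans (coeff-∷-*ₚ c f g (suc i))
    (cong₂ ℤ._+_ (c·g-vanishes i (ℕP.<-≤-trans (s≤s (ℕP.m≤n+m b (suc a))) (s≤s a+b<i))) (vanish (proj₁ ih) i a+b<i))
  top : coeff ((c ∷ f) *ₚ g) (suc (a + b)) ≡ coeff f a ℤ.* coeff g b
  top = trans (coeff-∷-*ₚ c f g (suc (a + b)))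
    (trans (cong₂ ℤ._+_ (c·g-vanishes (a + b) (s≤s (ℕP.m≤n+m b a))) (proj₂ ih)) (ℤP.+-identityˡ _))

Monic : ℕ → Poly → Set
Monic d G = DegreeBelow (suc d) G × coeff G d ≡ 1ℤ

monic-cong : ∀ {d f g} → f ≈ g → Monic d f → Monic d g
monic-cong e (df , lead) = degreeBelow-cong e df , trans (sym (at e _)) lead

monic-*ₚ : ∀ {a b f g} → Monic a f → Monic b g → Monic (a + b) (f *ₚ g)
monic-*ₚ {a} {b} {f} {g} (df , lf) (dg , lg) = proj₁ top , trans (proj₂ top) (cong₂ ℤ._*_ lf lg)
  where top = *ₚ-leading a b f g df dg

monic-length : ∀ {d G} → length G ≡ suc d → coeff G d ≡ 1ℤ → Monic d G
monic-length {G = G} len lead = subst (λ k → DegreeBelow k G) len (degreeBelow-length G) , lead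

monic-[1] : Monic 0 [ 1ℤ ]
monic-[1] = monic-length refl refl

monic-factor-degreeBelow : ∀ {d G K E} → Monic d G → DegreeBelow (K + d) (G *ₚ E) → DegreeBelow K E
monic-factor-degreeBelow {d} {G} {K} {E} (dG , lead) dGE = descend (length E) (degreeBelow-length E)
  where
  descend : ∀ j → DegreeBelow j E → DegreeBelow K E
  descend zero    dE = degreeBelow-mono z≤n dE
  descend (suc j) dE with suc j ℕP.≤? K
  ... | yes 1+j≤K = degreeBelow-mono 1+j≤K dE
  ... | no  1+j≰K = descend j (degreeBelow-pred dE Eⱼ≡0)
    where
    K+d≤d+j : K + d ≤ d + j
    K+d≤d+j = ℕP.≤-trans (ℕP.≤-reflexive (ℕP.+-comm K d)) (ℕP.+-monoʳ-≤ d (ℕP.≤-pred (ℕP.≰⇒> 1+j≰K)))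
    Eⱼ≡0 : coeff E j ≡ +0
    Eⱼ≡0 = let open ≡-Reasoning in begin
      coeff E j                        ≡⟨ ℤP.*-identityˡ (coeff E j) ⟨
      1ℤ ℤ.* coeff E j                ≡⟨ cong (ℤ._* coeff E j) lead ⟨
      coeff G d ℤ.* coeff E j          ≡⟨ proj₂ (*ₚ-leading d j G E dG dE) ⟨
      coeff (G *ₚ E) (d + j)           ≡⟨ vanish dGE (d + j) K+d≤d+j ⟩
      +0                               ∎

monic-*ₚ-cancelˡ : ∀ {d G A B} → Monic d G → G *ₚ A ≈ G *ₚ B → A ≈ B
monic-*ₚ-cancelˡ {d} {G} {A} {B} mG GA≈GB = mk≈ λ i →
  ℤP.i-j≡0⇒i≡j (coeff A i) (coeff B i) (trans (sym (coeff--ₚ A B i)) (vanish A-B-vanishes i z≤n))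
  where
  G[A-B]≈0 : G *ₚ (A -ₚ B) ≈ []
  G[A-B]≈0 = let open ≈-Reasoning in begin
    G *ₚ (A -ₚ B)          ≈⟨ *ₚ-distribˡ--ₚ G A B ⟩
    G *ₚ A -ₚ G *ₚ B       ≈⟨ -ₚ-cong GA≈GB (≈-refl {G *ₚ B}) ⟩
    G *ₚ B -ₚ G *ₚ B       ≈⟨ -ₚ-inverseʳ (G *ₚ B) ⟩
    []                     ∎
  A-B-vanishes : DegreeBelow 0 (A -ₚ B)
  A-B-vanishes = monic-factor-degreeBelow mG (mkDegreeBelow λ i _ → at G[A-B]≈0 i)

-- The Agda name of the loop local to quotMonic, obtained by unifying it with
-- a one-step unfolding of quotMonic; this lets us reason by induction on it.
mutual
  divisionLoop : Poly → Poly → ℕ → Poly → Poly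
  divisionLoop = _

  private
    quotMonic-unfold : ∀ F G k → length F ∸ (length G ∸ 1) ≡ suc k →
      quotMonic F G ≡ divisionLoop F G k (F -ₚ shift k (coeff F (k + (length G ∸ 1)) ·ₚ G))
                        ++ [ coeff F (k + (length G ∸ 1)) ]
    quotMonic-unfold F G k eq with length F ∸ (length G ∸ 1)
    quotMonic-unfold F G k refl | .(suc k) with F -ₚ shift k (coeff F (k + (length G ∸ 1)) ·ₚ G)
    ... | r = refl

length-divisionLoop : ∀ F G k r → length (divisionLoop F G k r) ≡ k
length-divisionLoop F G zero    r = refl
length-divisionLoop F G (suc k) r =
  trans (ListP.length-++ (divisionLoop F G k _)) (trans (cong (_+ 1) (length-divisionLoop F G k _)) (ℕP.+-comm k 1))

divisionLoop-exact : ∀ F G → Monic (length G ∸ 1) G →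
  ∀ k {E r} → DegreeBelow k E → r ≈ G *ₚ E → divisionLoop F G k r ≈ E
divisionLoop-exact F G mG zero    dE r≈GE = ≈-sym (degreeBelow-0 dE)
divisionLoop-exact F G mG (suc k) {E} {r} dE r≈GE = let open ≈-Reasoning in begin
  L ++ [ c ]                       ≈⟨ ++-[c] L c ⟩
  L +ₚ shift (length L) [ c ]      ≡⟨ cong (λ m → L +ₚ shift m [ c ]) (length-divisionLoop F G k r′) ⟩
  L +ₚ shift k [ c ]               ≈⟨ +ₚ-congˡ (shift k [ c ]) ih ⟩
  E′ +ₚ shift k [ c ]              ≈⟨ -ₚ-+ₚ-cancel E (shift k [ c ]) ⟩
  E                                ∎
  where
  d = length G ∸ 1
  c = coeff r (k + d)
  E′ = E -ₚ shift k [ c ]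
  r′ = r -ₚ shift k (c ·ₚ G)
  L = divisionLoop F G k r′
  c≡Eₖ : c ≡ coeff E k
  c≡Eₖ = let open ≡-Reasoning in begin
    coeff r (k + d)                  ≡⟨ at r≈GE (k + d) ⟩
    coeff (G *ₚ E) (k + d)           ≡⟨ cong (coeff (G *ₚ E)) (ℕP.+-comm k d) ⟩
    coeff (G *ₚ E) (d + k)           ≡⟨ proj₂ (*ₚ-leading d k G E (proj₁ mG) dE) ⟩
    coeff G d ℤ.* coeff E k          ≡⟨ cong (ℤ._* coeff E k) (proj₂ mG) ⟩
    1ℤ ℤ.* coeff E k                ≡⟨ ℤP.*-identityˡ (coeff E k) ⟩
    coeff E k                        ∎
  r′≈GE′ : r′ ≈ G *ₚ E′
  r′≈GE′ = let open ≈-Reasoning in ≈-sym (begin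
    G *ₚ E′                            ≈⟨ *ₚ-distribˡ--ₚ G E (shift k [ c ]) ⟩
    G *ₚ E -ₚ G *ₚ shift k [ c ]       ≈⟨ -ₚ-cong (≈-sym r≈GE) (shift-*ₚʳ k G [ c ]) ⟩
    r -ₚ shift k (G *ₚ [ c ])          ≈⟨ -ₚ-cong (≈-refl {r}) (shift-cong k (*ₚ-[c] G c)) ⟩
    r′                                 ∎)
  E′ₖ≡0 : coeff E′ k ≡ +0
  E′ₖ≡0 = trans (coeff--ₚ E (shift k [ c ]) k)
    (trans (cong₂ ℤ._-_ (sym c≡Eₖ) (coeff-shift-[c] k c)) (ℤP.+-inverseʳ c))
  dE′ : DegreeBelow k E′
  dE′ = degreeBelow-pred (degreeBelow--ₚ dE (degreeBelow-shift-[c] k c)) E′ₖ≡0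
  ih : L ≈ E′
  ih = divisionLoop-exact F G mG k dE′ r′≈GE′

quotMonic-exact : ∀ {F G E} → Monic (length G ∸ 1) G → G *ₚ E ≈ F → quotMonic F G ≈ E
quotMonic-exact {F} {G} {E} mG GE≈F = divisionLoop-exact F G mG K dE (≈-sym GE≈F)
  where
  d = length G ∸ 1
  K = length F ∸ d
  dE : DegreeBelow K E
  dE = monic-factor-degreeBelow mG (mkDegreeBelow λ i K+d≤i → trans (at GE≈F i)
         (coeff-≥length F (ℕP.≤-trans (ℕP.≤-trans (ℕP.m≤n+m∸n (length F) d) (ℕP.≤-reflexive (ℕP.+-comm d K))) K+d≤i)))

length-quotMonic : ∀ F G → length (quotMonic F G) ≡ length F ∸ (length G ∸ 1)
length-quotMonic F G = length-divisionLoop F G _ F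

-- Geometric sums

geom : ℕ → ℕ → Poly
geom k zero    = []
geom k (suc m) = geom k m +ₚ x^ (k * m)

repunit : ℕ → Poly
repunit = geom 1

x-1 : Poly
x-1 = xⁿ-1 1

xⁿ-1-cong : ∀ {a b} → a ≡ b → xⁿ-1 a ≈ xⁿ-1 b
xⁿ-1-cong refl = ≈-refl

xⁿ-1-*ₚ-geom : ∀ k m → xⁿ-1 k *ₚ geom k m ≈ xⁿ-1 (k * m)
xⁿ-1-*ₚ-geom k zero    = begin
  xⁿ-1 k *ₚ []         ≈⟨ *ₚ-zeroʳ (xⁿ-1 k) ⟩
  []                   ≈⟨ -ₚ-inverseʳ [ 1ℤ ] ⟨
  xⁿ-1 0               ≈⟨ xⁿ-1-cong (ℕP.*-zeroʳ k) ⟨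
  xⁿ-1 (k * 0)         ∎
  where open ≈-Reasoning
xⁿ-1-*ₚ-geom k (suc m) = begin
  xⁿ-1 k *ₚ (geom k m +ₚ x^ (k * m))                  ≈⟨ *ₚ-distribˡ-+ₚ (xⁿ-1 k) (geom k m) _ ⟩
  xⁿ-1 k *ₚ geom k m +ₚ xⁿ-1 k *ₚ x^ (k * m)          ≈⟨ +ₚ-cong (xⁿ-1-*ₚ-geom k m) (*ₚ-x^ (xⁿ-1 k) (k * m)) ⟩
  xⁿ-1 (k * m) +ₚ shift (k * m) (xⁿ-1 k)              ≈⟨ +ₚ-congʳ (xⁿ-1 (k * m)) (shift--ₚ (k * m) (x^ k) [ 1ℤ ]) ⟩
  xⁿ-1 (k * m) +ₚ (shift (k * m) (x^ k) -ₚ x^ (k * m)) ≈⟨ -ₚ-telescope [ 1ℤ ] (x^ (k * m)) _ ⟩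
  shift (k * m) (x^ k) -ₚ [ 1ℤ ]                      ≡⟨ cong (_-ₚ [ 1ℤ ]) (shift-shift (k * m) k [ 1ℤ ]) ⟩
  xⁿ-1 (k * m + k)                                     ≈⟨ xⁿ-1-cong (trans (ℕP.+-comm (k * m) k) (sym (ℕP.*-suc k m))) ⟩
  xⁿ-1 (k * suc m)                                     ∎
  where open ≈-Reasoning

x-1-*ₚ-repunit : ∀ m → x-1 *ₚ repunit m ≈ xⁿ-1 m
x-1-*ₚ-repunit m = ≈-trans (xⁿ-1-*ₚ-geom 1 m) (xⁿ-1-cong (ℕP.*-identityˡ m))

x-1-difference : ∀ m → x-1 ≈ xⁿ-1 (suc m) -ₚ shift 1 (xⁿ-1 m)
x-1-difference m = ≈-sym (≈-trans (-ₚ-cong (≈-refl {xⁿ-1 (suc m)}) (shift--ₚ 1 (x^ m) [ 1ℤ ]))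
                                  (-ₚ--ₚ-cancelˡ [ 1ℤ ] (x^ 1) (x^ (suc m))))

coeff-geom : ∀ k m j → coeff (geom (suc k) m) j ≡ +0
                      ⊎ Σ[ t ∈ ℕ ] (t < m × j ≡ suc k * t × coeff (geom (suc k) m) j ≡ 1ℤ)
coeff-geom k zero    j = inj₁ refl
coeff-geom k (suc m) j with j ℕ.≟ suc k * m | coeff-geom k m j
... | yes refl | inj₁ z = inj₂ (m , ℕP.n<1+n m , refl ,
      trans (coeff-+ₚ (geom (suc k) m) (x^ (suc k * m)) j) (cong₂ ℤ._+_ z (coeff-shift-[c] (suc k * m) 1ℤ)))
... | yes refl | inj₂ (t , t<m , j≡kt , _) = ⊥-elim (ℕP.<-irrefl (sym (ℕP.*-cancelˡ-≡ m t (suc k) j≡kt)) t<m)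
... | no  j≢km | inj₁ z = inj₁
      (trans (coeff-+ₚ (geom (suc k) m) (x^ (suc k * m)) j) (cong₂ ℤ._+_ z (coeff-x^-≢ (suc k * m) j≢km)))
... | no  j≢km | inj₂ (t , t<m , j≡kt , one) = inj₂ (t , ℕP.m≤n⇒m≤1+n t<m , j≡kt ,
      trans (coeff-+ₚ (geom (suc k) m) (x^ (suc k * m)) j) (trans (cong₂ ℤ._+_ one (coeff-x^-≢ (suc k * m) j≢km)) refl))

coeff-geom-multiple : ∀ k {m t} → t < m → coeff (geom (suc k) m) (suc k * t) ≡ 1ℤ
coeff-geom-multiple k {suc m} {t} (s≤s t≤m) =
  trans (coeff-+ₚ (geom (suc k) m) (x^ (suc k * m)) (suc k * t)) (case ℕP.m≤n⇒m<n∨m≡n t≤m of λ where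
    (inj₁ t<m)  → cong₂ ℤ._+_ (coeff-geom-multiple k t<m)
                    (coeff-x^-≢ (suc k * m) (λ kt≡km → ℕP.<-irrefl (ℕP.*-cancelˡ-≡ t m (suc k) kt≡km) t<m))
    (inj₂ refl) → cong₂ ℤ._+_ (not-yet-present m) (coeff-shift-[c] (suc k * m) 1ℤ))
  where
  not-yet-present : ∀ m → coeff (geom (suc k) m) (suc k * m) ≡ +0
  not-yet-present m with coeff-geom k m (suc k * m)
  ... | inj₁ z = z
  ... | inj₂ (t , t<m , km≡kt , _) = ⊥-elim (ℕP.<-irrefl (sym (ℕP.*-cancelˡ-≡ m t (suc k) km≡kt)) t<m)

coeff-repunit-< : ∀ {m i} → i < m → coeff (repunit m) i ≡ 1ℤ
coeff-repunit-< {m} {i} i<m = trans (cong (coeff (repunit m)) (sym (ℕP.*-identityˡ i))) (coeff-geom-multiple 0 i<m)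

degreeBelow-repunit : ∀ m → DegreeBelow m (repunit m)
degreeBelow-repunit m = mkDegreeBelow λ j m≤j → case coeff-geom 0 m j of λ where
  (inj₁ z)                   → z
  (inj₂ (t , t<m , j≡t , _)) → ⊥-elim (ℕP.<-irrefl refl
                                  (ℕP.<-≤-trans t<m (ℕP.≤-trans m≤j (ℕP.≤-reflexive (trans j≡t (ℕP.*-identityˡ t))))))

monic-repunit : ∀ m → Monic m (repunit (suc m))
monic-repunit m = degreeBelow-repunit (suc m) , coeff-repunit-< (ℕP.n<1+n m)

monic-x-1 : Monic 1 x-1
monic-x-1 = monic-length refl refl

length-xⁿ-1 : ∀ k → length (xⁿ-1 k) ≡ suc k
length-xⁿ-1 k = begin
  length (x^ k +ₚ negₚ [ 1ℤ ])        ≡⟨ length-+ₚ (x^ k) (negₚ [ 1ℤ ]) ⟩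
  length (x^ k) ⊔ 1                   ≡⟨ cong (_⊔ 1) (trans (ListP.length-++ (replicate k +0)) (cong (_+ 1) (ListP.length-replicate k))) ⟩
  (k + 1) ⊔ 1                         ≡⟨ ℕP.m≥n⇒m⊔n≡m (ℕP.m≤n+m 1 k) ⟩
  k + 1                               ≡⟨ ℕP.+-comm k 1 ⟩
  suc k                               ∎
  where open ≡-Reasoning

monic-xⁿ-1 : ∀ k → Monic (suc k) (xⁿ-1 (suc k))
monic-xⁿ-1 k = monic-length (length-xⁿ-1 (suc k))
  (trans (coeff--ₚ (x^ (suc k)) [ 1ℤ ] (suc k)) (cong (ℤ._- +0) (coeff-shift-[c] (suc k) 1ℤ)))

*ₚ-xⁿ-1-*ₚ-xⁿ-1 : ∀ f A B → f *ₚ (xⁿ-1 A *ₚ xⁿ-1 B) ≈ (shift (A + B) f -ₚ shift B f) -ₚ (shift A f -ₚ f)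
*ₚ-xⁿ-1-*ₚ-xⁿ-1 f A B = begin
  f *ₚ (xⁿ-1 A *ₚ xⁿ-1 B)                               ≈⟨ *ₚ-assoc f (xⁿ-1 A) (xⁿ-1 B) ⟨
  (f *ₚ xⁿ-1 A) *ₚ xⁿ-1 B                               ≈⟨ *ₚ-congˡ (xⁿ-1 B) (*ₚ-xⁿ-1 f A) ⟩
  (shift A f -ₚ f) *ₚ xⁿ-1 B                            ≈⟨ *ₚ-xⁿ-1 (shift A f -ₚ f) B ⟩
  shift B (shift A f -ₚ f) -ₚ (shift A f -ₚ f)          ≈⟨ -ₚ-cong (shift--ₚ B (shift A f) f) (≈-refl {shift A f -ₚ f}) ⟩
  (shift B (shift A f) -ₚ shift B f) -ₚ (shift A f -ₚ f) ≡⟨ cong (λ g → (g -ₚ shift B f) -ₚ (shift A f -ₚ f))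
                                                               (trans (shift-shift B A f) (cong (λ k → shift k f) (ℕP.+-comm B A))) ⟩
  (shift (A + B) f -ₚ shift B f) -ₚ (shift A f -ₚ f)    ∎
  where open ≈-Reasoning

spikes : ℕ → ℕ → Poly
spikes k m = shift k (geom (suc k) m)

private
  suc-*-suc : ∀ k t → suc k * suc t ≡ suc (k + suc k * t)
  suc-*-suc = solve-∀ℕ

coeff-spikes : ∀ k m i → coeff (spikes k m) i ≡ +0 ⊎ Σ[ t ∈ ℕ ] (t < m × suc i ≡ suc k * suc t)
coeff-spikes k m i with i ℕP.<? k
... | yes i<k = inj₁ (coeff-shift-< k _ i<k)
... | no  i≮k with ℕP.m≤n⇒∃[o]m+o≡n (ℕP.≮⇒≥ i≮k)
...   | j , refl with coeff-geom k m j
...     | inj₁ z                    = inj₁ (trans (coeff-shift-+ k _ j) z)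
...     | inj₂ (t , t<m , refl , _) = inj₂ (t , t<m , sym (suc-*-suc k t))

coeff-spikes-at : ∀ k {m t i} → t < m → suc i ≡ suc k * suc t → coeff (spikes k m) i ≡ 1ℤ
coeff-spikes-at k {m} {t} {i} t<m 1+i≡kt = trans (cong (coeff (spikes k m)) i≡k+kt)
  (trans (coeff-shift-+ k _ (suc k * t)) (coeff-geom-multiple k t<m))
  where
  i≡k+kt : i ≡ k + suc k * t
  i≡k+kt = ℕP.suc-injective (trans 1+i≡kt (suc-*-suc k t))

-- Degree and the shape of the polynomials in 𝒜

isZeroPoly⇒≈[] : ∀ f → isZeroPoly f ≡ true → f ≈ []
isZeroPoly⇒≈[] []      _  = ≈-refl
isZeroPoly⇒≈[] (a ∷ f) z with a ℤ.≟ +0 | isZeroPoly f in zf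
... | yes refl | true = mk≈ λ { zero → refl ; (suc i) → at (isZeroPoly⇒≈[] f zf) i }

≈[]⇒isZeroPoly : ∀ f → f ≈ [] → isZeroPoly f ≡ true
≈[]⇒isZeroPoly []      _ = refl
≈[]⇒isZeroPoly (a ∷ f) e with a ℤ.≟ +0
... | yes _  = ≈[]⇒isZeroPoly f (mk≈ λ i → at e (suc i))
... | no a≢0 = ⊥-elim (a≢0 (at e zero))

coeff≢0⇒≤deg : ∀ f {i} → coeff f i ≢ +0 → i ≤ deg f
coeff≢0⇒≤deg []      fᵢ≢0 = ⊥-elim (fᵢ≢0 refl)
coeff≢0⇒≤deg (a ∷ f) {zero}  fᵢ≢0 = z≤n
coeff≢0⇒≤deg (a ∷ f) {suc i} fᵢ≢0 with isZeroPoly f in zf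
... | true  = ⊥-elim (fᵢ≢0 (at (isZeroPoly⇒≈[] f zf) i))
... | false = s≤s (coeff≢0⇒≤deg f fᵢ≢0)

degreeBelow⇒deg≤ : ∀ f {i} → DegreeBelow (suc i) f → deg f ≤ i
degreeBelow⇒deg≤ []      _ = z≤n
degreeBelow⇒deg≤ (a ∷ f) {i} df with isZeroPoly f in zf
... | true  = z≤n
... | false with i
...   | zero  = case trans (sym zf) (≈[]⇒isZeroPoly f (degreeBelow-0 (degreeBelow-tail df))) of λ ()
...   | suc i = s≤s (degreeBelow⇒deg≤ f (degreeBelow-tail df))

deg-monic : ∀ {m f} → Monic m f → deg f ≡ m
deg-monic {m} {f} (df , lead) =
  ℕP.≤-antisym (degreeBelow⇒deg≤ f df) (coeff≢0⇒≤deg f (λ fₘ≡0 → case trans (sym lead) fₘ≡0 of λ ()))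

NonpositiveExcept : ℕ → Poly → Set
NonpositiveExcept m f = ∀ {i} → i ≢ m → coeff f i ℤ.≤ +0

nonpositiveExcept-cong : ∀ {m f g} → f ≈ g → NonpositiveExcept m f → NonpositiveExcept m g
nonpositiveExcept-cong {g = g} e nf {i} i≢m = subst (ℤ._≤ +0) (at e i) (nf i≢m)

negBits : ∀ {k} → Vec Bool k → Poly
negBits bs = map (λ b → - bit b) (Vec.toList bs)

length-negBits : ∀ {k} (bs : Vec Bool k) → length (negBits bs) ≡ k
length-negBits bs = trans (ListP.length-map _ (Vec.toList bs)) (VecP.length-toList bs)

coeff-negBits : ∀ {k} (bs : Vec Bool k) (j : Fin k) → coeff (negBits bs) (Fin.toℕ j) ≡ - bit (Vec.lookup bs j)
coeff-negBits (b Vec.∷ bs) Fin.zero    = refl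
coeff-negBits (b Vec.∷ bs) (Fin.suc j) = coeff-negBits bs j

negBits-nonpositive : ∀ {k} (bs : Vec Bool k) i → coeff (negBits bs) i ℤ.≤ +0
negBits-nonpositive Vec.[]           i       = ℤP.≤-refl
negBits-nonpositive (true Vec.∷ bs)  zero    = ℤ.-≤+
negBits-nonpositive (false Vec.∷ bs) zero    = ℤP.≤-refl
negBits-nonpositive (b Vec.∷ bs)     (suc i) = negBits-nonpositive bs i

monic-fA : ∀ k (bs : Vec Bool k) → Monic (suc k) (fA (suc k) bs)
monic-fA k bs = monic-length (cong suc length-body) lead
  where
  length-body : length (negBits bs ++ [ 1ℤ ]) ≡ suc k
  length-body = trans (ListP.length-++ (negBits bs)) (trans (cong (_+ 1) (length-negBits bs)) (ℕP.+-comm k 1))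
  lead : coeff (negBits bs ++ [ 1ℤ ]) k ≡ 1ℤ
  lead = trans (cong (coeff (negBits bs ++ [ 1ℤ ])) (sym (trans (ℕP.+-identityʳ _) (length-negBits bs))))
               (coeff-++-+ (negBits bs) [ 1ℤ ] 0)

++-[1]-nonpositiveExcept : ∀ l → (∀ j → coeff l j ℤ.≤ +0) → NonpositiveExcept (length l) (l ++ [ 1ℤ ])
++-[1]-nonpositiveExcept []      _  {zero}  0≢0 = ⊥-elim (0≢0 refl)
++-[1]-nonpositiveExcept []      _  {suc i} _   = ℤP.≤-refl
++-[1]-nonpositiveExcept (x ∷ l) nl {zero}  _   = nl zero
++-[1]-nonpositiveExcept (x ∷ l) nl {suc i} i≢l = ++-[1]-nonpositiveExcept l (λ j → nl (suc j)) (λ i≡l → i≢l (cong suc i≡l))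

fA-nonpositiveExcept : ∀ k (bs : Vec Bool k) → NonpositiveExcept (suc k) (fA (suc k) bs)
fA-nonpositiveExcept k bs {zero}  _     = ℤ.-≤+
fA-nonpositiveExcept k bs {suc i} i≢1+k = ++-[1]-nonpositiveExcept (negBits bs) (negBits-nonpositive bs)
  (λ i≡l → i≢1+k (cong suc (trans i≡l (length-negBits bs))))

fA-realises : ∀ k g → coeff g 0 ≡ -1ℤ → coeff g (suc k) ≡ 1ℤ →
  (∀ {i} → i < k → coeff g (suc i) ≡ +0 ⊎ coeff g (suc i) ≡ -1ℤ) → DegreeBelow (suc (suc k)) g →
  Σ[ bs ∈ Vec Bool k ] g ≈ fA (suc k) bs
fA-realises k g g₀≡-1 gₖ≡1 middle dg = bs , mk≈ coeffs
  where
  choose : ∀ {z} → z ≡ +0 ⊎ z ≡ -1ℤ → Σ[ b ∈ Bool ] - bit b ≡ z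
  choose (inj₁ refl) = false , refl
  choose (inj₂ refl) = true , refl
  bs : Vec Bool k
  bs = Vec.tabulate (λ j → proj₁ (choose (middle (FinP.toℕ<n j))))
  body = negBits bs
  length-body : length body ≡ k
  length-body = length-negBits bs
  coeffs : ∀ i → coeff g i ≡ coeff (fA (suc k) bs) i
  coeffs zero    = g₀≡-1
  coeffs (suc i) with ℕP.<-cmp i k
  ... | tri< i<k _ _ = sym (begin
    coeff (body ++ [ 1ℤ ]) i                    ≡⟨ coeff-++-< body [ 1ℤ ] (subst (i <_) (sym length-body) i<k) ⟩
    coeff body i                                ≡⟨ cong (coeff body) (FinP.toℕ-fromℕ< i<k) ⟨
    coeff body (Fin.toℕ (Fin.fromℕ< i<k))       ≡⟨ coeff-negBits bs (Fin.fromℕ< i<k) ⟩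
    - bit (Vec.lookup bs (Fin.fromℕ< i<k))      ≡⟨ cong (λ b → - bit b) (VecP.lookup∘tabulate _ (Fin.fromℕ< i<k)) ⟩
    - bit (proj₁ (choose (middle j<k)))         ≡⟨ proj₂ (choose (middle j<k)) ⟩
    coeff g (suc (Fin.toℕ (Fin.fromℕ< i<k)))    ≡⟨ cong (λ j → coeff g (suc j)) (FinP.toℕ-fromℕ< i<k) ⟩
    coeff g (suc i)                             ∎)
    where
    open ≡-Reasoning
    j<k = FinP.toℕ<n (Fin.fromℕ< i<k)
  ... | tri≈ _ refl _ = trans gₖ≡1 (sym (proj₂ (monic-fA k bs)))
  ... | tri> _ _ k<i = trans (vanish dg (suc i) (s≤s k<i)) (sym (vanish (proj₁ (monic-fA k bs)) (suc i) (s≤s k<i)))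

shift-nonpositiveExcept : ∀ {m f} k → NonpositiveExcept m f → NonpositiveExcept (k + m) (shift k f)
shift-nonpositiveExcept {m} {f} k nf {i} i≢k+m with i ℕP.<? k
... | yes i<k = ℤP.≤-reflexive (coeff-shift-< k f i<k)
... | no  i≮k with ℕP.m≤n⇒∃[o]m+o≡n (ℕP.≮⇒≥ i≮k)
...   | j , refl = subst (ℤ._≤ +0) (sym (coeff-shift-+ k f j)) (nf (λ j≡m → i≢k+m (cong (k +_) j≡m)))

coeff-xⁿ-1-*ₚ-antiperiodic : ∀ n {V} → DegreeBelow n V → ∀ {i} → i < n →
  coeff (xⁿ-1 n *ₚ V) (n + i) ≡ - coeff (xⁿ-1 n *ₚ V) i
coeff-xⁿ-1-*ₚ-antiperiodic n {V} dV {i} i<n = begin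
  coeff (xⁿ-1 n *ₚ V) (n + i)                  ≡⟨ coeff-xⁿ-1V (n + i) ⟩
  coeff (shift n V) (n + i) ℤ.- coeff V (n + i) ≡⟨ cong₂ ℤ._-_ (coeff-shift-+ n V i) (vanish dV (n + i) (ℕP.m≤m+n n i)) ⟩
  coeff V i ℤ.- +0                             ≡⟨ negate (coeff V i) ⟩
  - (+0 ℤ.- coeff V i)                         ≡⟨ cong (λ x → - (x ℤ.- coeff V i)) (coeff-shift-< n V i<n) ⟨
  - (coeff (shift n V) i ℤ.- coeff V i)        ≡⟨ cong -_ (coeff-xⁿ-1V i) ⟨
  - coeff (xⁿ-1 n *ₚ V) i                      ∎
  where
  open ≡-Reasoning
  negate : ∀ v → v ℤ.- +0 ≡ - (+0 ℤ.- v)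
  negate = solve-∀
  coeff-xⁿ-1V : ∀ j → coeff (xⁿ-1 n *ₚ V) j ≡ coeff (shift n V) j ℤ.- coeff V j
  coeff-xⁿ-1V j = trans (at (*ₚ-comm (xⁿ-1 n) V) j) (trans (at (*ₚ-xⁿ-1 V n) j) (coeff--ₚ (shift n V) V j))

private
  sign-clash : ∀ {x y u w} → x ℤ.≤ +0 → y ℤ.≤ +0 → u ℤ.≤ +0 → w ℤ.≤ +0 →
    ((+0 ℤ.- x) ℤ.- (y ℤ.- +0)) ℤ.+ ((1ℤ ℤ.- u) ℤ.- (w ℤ.- +0)) ≡ +0 → ⊥
  sign-clash {x} {y} {u} {w} x≤0 y≤0 u≤0 w≤0 sum≡0 =
    case subst (ℤ._≤ +0) x+y+u+w≡1 (ℤP.+-mono-≤ (ℤP.+-mono-≤ (ℤP.+-mono-≤ x≤0 y≤0) u≤0) w≤0) of λ { (ℤ.+≤+ ()) }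
    where
    regroup : ∀ x y u w → x ℤ.+ y ℤ.+ u ℤ.+ w ≡ 1ℤ ℤ.- (((+0 ℤ.- x) ℤ.- (y ℤ.- +0)) ℤ.+ ((1ℤ ℤ.- u) ℤ.- (w ℤ.- +0)))
    regroup = solve-∀
    x+y+u+w≡1 : x ℤ.+ y ℤ.+ u ℤ.+ w ≡ 1ℤ
    x+y+u+w≡1 = trans (regroup x y u w) (cong (λ z → 1ℤ ℤ.- z) sum≡0)

-- Reading f (x^A - 1)(x^B - 1) = x^(n+1) f - x^B f - x^A f + f modulo x^n - 1,
-- the coefficient of x^(m+1) would be 1 minus nonpositive terms.
xⁿ-1-∤-*ₚ-xᴬ-1-*ₚ-xᴮ-1 : ∀ {n m A B f} V → suc m < n → 2 ≤ A → 2 ≤ B → A + B ≡ suc n →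
  Monic m f → NonpositiveExcept m f → ¬ (f *ₚ (xⁿ-1 A *ₚ xⁿ-1 B) ≈ xⁿ-1 n *ₚ V)
xⁿ-1-∤-*ₚ-xᴬ-1-*ₚ-xᴮ-1 {n@(suc n′)} {m} {A} {B} {f} V 1+m<n 2≤A 2≤B A+B≡1+n (df , fₘ≡1) nf fAB≈xⁿ-1V =
  sign-clash (low-term B 2≤B) (low-term A 2≤A) (high-term B B<1+n) (high-term A A<1+n)
    (trans (sym (cong₂ ℤ._+_ coeff-W-low coeff-W-high)) W-opposite)
  where
  open ≡-Reasoning
  A<1+n : A < suc n
  A<1+n = subst (A <_) A+B≡1+n (ℕP.m<m+n A (ℕP.<-trans (s≤s z≤n) 2≤B))
  B<1+n : B < suc n
  B<1+n = subst (B <_) (trans (ℕP.+-comm B A) A+B≡1+n) (ℕP.m<m+n B (ℕP.<-trans (s≤s z≤n) 2≤A))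
  low-term : ∀ k → 2 ≤ k → coeff (shift k f) (suc m) ℤ.≤ +0
  low-term k 2≤k = shift-nonpositiveExcept k nf (λ e → ℕP.<-irrefl e (ℕP.+-monoˡ-< m 2≤k))
  high-term : ∀ k → k < suc n → coeff (shift k f) (suc n + m) ℤ.≤ +0
  high-term k k<1+n = shift-nonpositiveExcept k nf (λ e → ℕP.<-irrefl (sym (ℕP.+-cancelʳ-≡ m (suc n) k e)) k<1+n)
  W = (shift (suc n) f -ₚ shift B f) -ₚ (shift A f -ₚ f)
  W≈xⁿ-1V : W ≈ xⁿ-1 n *ₚ V
  W≈xⁿ-1V = ≈-trans (≈-sym (subst (λ k → f *ₚ (xⁿ-1 A *ₚ xⁿ-1 B) ≈ (shift k f -ₚ shift B f) -ₚ (shift A f -ₚ f))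
                                   A+B≡1+n (*ₚ-xⁿ-1-*ₚ-xⁿ-1 f A B))) fAB≈xⁿ-1V
  dW : DegreeBelow (suc n + suc m) W
  dW = degreeBelow--ₚ
    (degreeBelow--ₚ (degreeBelow-shift (suc n) df)
                    (degreeBelow-mono (ℕP.+-monoˡ-≤ (suc m) (ℕP.<⇒≤ B<1+n)) (degreeBelow-shift B df)))
    (degreeBelow--ₚ (degreeBelow-mono (ℕP.+-monoˡ-≤ (suc m) (ℕP.<⇒≤ A<1+n)) (degreeBelow-shift A df))
                    (degreeBelow-mono (ℕP.m≤n+m (suc m) (suc n)) df))
  dV : DegreeBelow n V
  dV = degreeBelow-mono 1+m<n (monic-factor-degreeBelow (monic-xⁿ-1 n′)
    (subst (λ k → DegreeBelow k (xⁿ-1 n *ₚ V)) (trans (ℕP.+-comm (suc n) (suc m)) (cong suc (ℕP.+-suc m n)))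
           (degreeBelow-cong W≈xⁿ-1V dW)))
  coeff-W : ∀ i → coeff W i ≡ (coeff (shift (suc n) f) i ℤ.- coeff (shift B f) i) ℤ.- (coeff (shift A f) i ℤ.- coeff f i)
  coeff-W i = trans (coeff--ₚ (shift (suc n) f -ₚ shift B f) (shift A f -ₚ f) i)
                    (cong₂ ℤ._-_ (coeff--ₚ (shift (suc n) f) (shift B f) i) (coeff--ₚ (shift A f) f i))
  coeff-W-low : coeff W (suc m) ≡ (+0 ℤ.- coeff (shift B f) (suc m)) ℤ.- (coeff (shift A f) (suc m) ℤ.- +0)
  coeff-W-low = trans (coeff-W (suc m))
    (cong₂ (λ a b → (a ℤ.- coeff (shift B f) (suc m)) ℤ.- (coeff (shift A f) (suc m) ℤ.- b))
           (coeff-shift-< (suc n) f (s≤s (ℕP.<⇒≤ 1+m<n))) (vanish df (suc m) ℕP.≤-refl))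
  coeff-W-high : coeff W (suc n + m) ≡ (1ℤ ℤ.- coeff (shift B f) (suc n + m)) ℤ.- (coeff (shift A f) (suc n + m) ℤ.- +0)
  coeff-W-high = trans (coeff-W (suc n + m))
    (cong₂ (λ a b → (a ℤ.- coeff (shift B f) (suc n + m)) ℤ.- (coeff (shift A f) (suc n + m) ℤ.- b))
           (trans (coeff-shift-+ (suc n) f m) fₘ≡1) (vanish df (suc n + m) (s≤s (ℕP.m≤n+m m n))))
  W-opposite : coeff W (suc m) ℤ.+ coeff W (suc n + m) ≡ +0
  W-opposite = begin
    coeff W (suc m) ℤ.+ coeff W (suc n + m)                    ≡⟨ cong₂ ℤ._+_ (at W≈xⁿ-1V (suc m)) (at W≈xⁿ-1V (suc n + m)) ⟩
    coeff (xⁿ-1 n *ₚ V) (suc m) ℤ.+ coeff (xⁿ-1 n *ₚ V) (suc n + m)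
      ≡⟨ cong (λ z → coeff (xⁿ-1 n *ₚ V) (suc m) ℤ.+ z)
              (trans (cong (coeff (xⁿ-1 n *ₚ V)) (sym (ℕP.+-suc n m))) (coeff-xⁿ-1-*ₚ-antiperiodic n dV 1+m<n)) ⟩
    coeff (xⁿ-1 n *ₚ V) (suc m) ℤ.- coeff (xⁿ-1 n *ₚ V) (suc m) ≡⟨ ℤP.+-inverseʳ (coeff (xⁿ-1 n *ₚ V) (suc m)) ⟩
    +0                                                         ∎

-- Arithmetic of two primes

prime⇒>1 : ∀ {p} → Prime p → 1 < p
prime⇒>1 {p} (Data.Nat.Primality.prime _) = ℕ.nonTrivial⇒n>1 p

suc-prime∸1 : ∀ {p} → Prime p → suc (p ∸ 1) ≡ p
suc-prime∸1 pp = ℕP.m+[n∸m]≡n (ℕP.<⇒≤ (prime⇒>1 pp))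

q<p*q : ∀ {p q} → Prime p → Prime q → q < p * q
q<p*q {p} {q} pp pq = ℕP.<-≤-trans (ℕP.m<m*n q p {{prime⇒nonZero pq}} (prime⇒>1 pp)) (ℕP.≤-reflexive (ℕP.*-comm q p))

prime∤⇒coprime : ∀ {p d} → Prime p → ¬ p ∣ d → Coprime p d
prime∤⇒coprime pp p∤d (i∣p , i∣d) with prime⇒irreducible pp i∣p
... | inj₁ i≡1  = i≡1
... | inj₂ refl = ⊥-elim (p∤d i∣d)

divisors-of-pq : ∀ {p q d} → Prime p → Prime q → d ∣ p * q → d ≡ 1 ⊎ d ≡ p ⊎ d ≡ q ⊎ d ≡ p * q
divisors-of-pq {p} {q} {d} pp pq d∣pq with p ∣? d
... | yes (divides e refl) with prime⇒irreducible pq (*-cancelˡ-∣ p {{prime⇒nonZero pp}} (subst (_∣ p * q) (ℕP.*-comm e p) d∣pq))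
...   | inj₁ refl = inj₂ (inj₁ (ℕP.*-identityˡ p))
...   | inj₂ refl = inj₂ (inj₂ (inj₂ (ℕP.*-comm e p)))
divisors-of-pq {p} {q} {d} pp pq d∣pq | no p∤d with prime⇒irreducible pq (coprime-divisor (Coprime.sym (prime∤⇒coprime pp p∤d)) d∣pq)
... | inj₁ d≡1 = inj₁ d≡1
... | inj₂ d≡q = inj₂ (inj₂ (inj₁ d≡q))

modular-inverse : ∀ {p q} → Coprime q p → 1 < p → Σ[ a ∈ ℕ ] Σ[ b ∈ ℕ ] (1 ≤ a × a < p × q * a ≡ 1 + b * p)
modular-inverse {p@(suc (suc k))} {q} q⊥p (s≤s (s≤s z≤n)) = a , (q * a) / p , 1≤a , m%n<n a₀ p , qa≡1+bp
  where
  inverse : Σ[ a₀ ∈ ℕ ] (q * a₀) % p ≡ 1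
  inverse with coprime-Bézout q⊥p
  ... | Bézout.+- x y 1+yp≡xq = x , (begin
    (q * x) % p        ≡⟨ %-congˡ (trans (ℕP.*-comm q x) (sym 1+yp≡xq)) ⟩
    (1 + y * p) % p    ≡⟨ [m+kn]%n≡m%n 1 y p ⟩
    1                  ∎)
    where open ≡-Reasoning
  ... | Bézout.-+ x y 1+xq≡yp = suc k * x , (begin
    (q * (suc k * x)) % p                   ≡⟨ [m+kn]%n≡m%n (q * (suc k * x)) y p ⟨
    (q * (suc k * x) + y * p) % p           ≡⟨ %-congˡ (cong (λ z → q * (suc k * x) + z) (sym 1+xq≡yp)) ⟩
    (q * (suc k * x) + (1 + x * q)) % p     ≡⟨ %-congˡ (regroup q k x) ⟩
    (1 + (x * q) * p) % p                   ≡⟨ [m+kn]%n≡m%n 1 (x * q) p ⟩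
    1                                       ∎)
    where
    open ≡-Reasoning
    regroup : ∀ q k x → q * (suc k * x) + (1 + x * q) ≡ 1 + (x * q) * suc (suc k)
    regroup = solve-∀ℕ
  a₀ = proj₁ inverse
  a = a₀ % p
  qa%p≡1 : (q * a) % p ≡ 1
  qa%p≡1 = begin
    (q * (a₀ % p)) % p                ≡⟨ %-distribˡ-* q (a₀ % p) p ⟩
    ((q % p) * (a₀ % p % p)) % p      ≡⟨ cong (λ z → ((q % p) * z) % p) (m%n%n≡m%n a₀ p) ⟩
    ((q % p) * (a₀ % p)) % p          ≡⟨ %-distribˡ-* q a₀ p ⟨
    (q * a₀) % p                      ≡⟨ proj₂ inverse ⟩
    1                                 ∎
    where open ≡-Reasoning
  qa≡1+bp : q * a ≡ 1 + (q * a) / p * p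
  qa≡1+bp = trans (m≡m%n+[m/n]*n (q * a) p) (cong (_+ (q * a) / p * p) qa%p≡1)
  1≤a : 1 ≤ a
  1≤a with a | qa%p≡1
  ... | zero  | q0%p≡1 = case trans (sym (cong (_% p) (ℕP.*-zeroʳ q))) q0%p≡1 of λ ()
  ... | suc _ | _      = s≤s z≤n

qa+pc≡1+pq : ∀ {p q} → Prime p → Prime q → p < q → Σ[ a ∈ ℕ ] Σ[ c ∈ ℕ ] (1 ≤ a × 1 ≤ c × q * a + p * c ≡ suc (p * q))
qa+pc≡1+pq {p} {q} pp pq p<q with modular-inverse {p} {q} (Coprime.prime⇒coprime pq {{prime⇒nonZero pp}} p<q) (prime⇒>1 pp)
... | a , b , 1≤a , a<p , qa≡1+bp with ℕP.m≤n⇒∃[o]m+o≡n b<q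
  where
  b<q : b < q
  b<q = ℕP.*-cancelʳ-< p b q (ℕP.<-≤-trans (subst (b * p <_) (sym qa≡1+bp) (ℕP.n<1+n _)) (ℕP.*-monoʳ-≤ q (ℕP.<⇒≤ a<p)))
...   | o , refl = a , suc o , 1≤a , s≤s z≤n , trans (cong (_+ p * suc o) qa≡1+bp) (regroup p b o)
  where
  regroup : ∀ p b o → 1 + b * p + p * suc o ≡ suc (p * (suc b + o))
  regroup = solve-∀ℕ

-- Cyclotomic polynomials of p and p q

Φ-unfold : ∀ m → Φ (suc m) ≡ quotMonic (xⁿ-1 (suc m)) (properDivProd (suc m) (cycTab m))
Φ-unfold m with suc m ℕ.≟ suc m
... | yes _   = refl
... | no  m≢m = ⊥-elim (m≢m refl)

cycTab-Φ : ∀ n {d} → 1 ≤ d → d ≤ n → cycTab n d ≡ Φ d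
cycTab-Φ zero    (s≤s _) ()
cycTab-Φ (suc n) {d} 1≤d d≤1+n with d ℕ.≟ suc n
... | yes refl = sym (Φ-unfold n)
... | no  d≢n  = cycTab-Φ n 1≤d (ℕP.≤-pred (ℕP.≤∧≢⇒< d≤1+n d≢n))

interval : ℕ → ℕ → List ℕ
interval a zero    = []
interval a (suc k) = a ∷ interval (suc a) k

interval-+ : ∀ a k l → interval a (k + l) ≡ interval a k ++ interval (a + k) l
interval-+ a zero    l = cong (λ b → interval b l) (sym (ℕP.+-identityʳ a))
interval-+ a (suc k) l = cong (a ∷_) (trans (interval-+ (suc a) k l) (cong (λ b → interval (suc a) k ++ interval b l) (sym (ℕP.+-suc a k))))

interval-split : ∀ {a b c} → a ≤ b → b ≤ c → interval a (c ∸ a) ≡ interval a (b ∸ a) ++ interval b (c ∸ b)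
interval-split {a} {b} {c} a≤b b≤c = begin
  interval a (c ∸ a)                              ≡⟨ cong (interval a) c∸a≡[b∸a]+[c∸b] ⟩
  interval a ((b ∸ a) + (c ∸ b))                  ≡⟨ interval-+ a (b ∸ a) (c ∸ b) ⟩
  interval a (b ∸ a) ++ interval (a + (b ∸ a)) (c ∸ b) ≡⟨ cong (λ x → interval a (b ∸ a) ++ interval x (c ∸ b)) (ℕP.m+[n∸m]≡n a≤b) ⟩
  interval a (b ∸ a) ++ interval b (c ∸ b)        ∎
  where
  open ≡-Reasoning
  c∸a≡[b∸a]+[c∸b] : c ∸ a ≡ (b ∸ a) + (c ∸ b)
  c∸a≡[b∸a]+[c∸b] = trans (cong (_∸ a) (sym (ℕP.m∸n+n≡m b≤c)))
    (trans (ℕP.+-∸-assoc (c ∸ b) a≤b) (ℕP.+-comm (c ∸ b) (b ∸ a)))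

divisorStep : ℕ → (ℕ → Poly) → ℕ → Poly → Poly
divisorStep m T d acc = if ⌊ d ∣? m ⌋ then T d *ₚ acc else acc

divisorStep-∣ : ∀ {m d} T acc → d ∣ m → divisorStep m T d acc ≡ T d *ₚ acc
divisorStep-∣ {m} {d} T acc d∣m with d ∣? m
... | yes _   = refl
... | no  d∤m = ⊥-elim (d∤m d∣m)

divisorStep-∤ : ∀ {m d} T acc → ¬ d ∣ m → divisorStep m T d acc ≡ acc
divisorStep-∤ {m} {d} T acc d∤m with d ∣? m
... | yes d∣m = ⊥-elim (d∤m d∣m)
... | no  _   = refl

applyUpTo-interval : ∀ f a k → (∀ i → f i ≡ a + i) → applyUpTo f k ≡ interval a k
applyUpTo-interval f a zero    f≗a+ = refl
applyUpTo-interval f a (suc k) f≗a+ = cong₂ _∷_ (trans (f≗a+ 0) (ℕP.+-identityʳ a))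
  (applyUpTo-interval (λ i → f (suc i)) (suc a) k (λ i → trans (f≗a+ (suc i)) (ℕP.+-suc a i)))

properDivProd-interval : ∀ m T → properDivProd m T ≡ foldr (divisorStep m T) [ 1ℤ ] (interval 1 (m ∸ 1))
properDivProd-interval m T = cong (foldr (divisorStep m T) [ 1ℤ ])
  (trans (ListP.map-applyUpTo (λ i → i) suc (m ∸ 1)) (applyUpTo-interval suc 1 (m ∸ 1) (λ _ → refl)))

foldr-divisorStep-none : ∀ {m} T z a k → (∀ {d} → a ≤ d → d < a + k → ¬ d ∣ m) →
  foldr (divisorStep m T) z (interval a k) ≡ z
foldr-divisorStep-none T z a zero    none = refl
foldr-divisorStep-none T z a (suc k) none = trans
  (cong (divisorStep _ T a) (foldr-divisorStep-none T z (suc a) k λ a<d d<1+a+k →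
    none (ℕP.<⇒≤ a<d) (ℕP.<-≤-trans d<1+a+k (ℕP.≤-reflexive (sym (ℕP.+-suc a k))))))
  (divisorStep-∤ T z (none ℕP.≤-refl (ℕP.m<m+n a (s≤s z≤n))))

foldr-divisorStep-segment : ∀ {m} T z {a b} → a < b → a ∣ m → (∀ {d} → a < d → d < b → ¬ d ∣ m) →
  foldr (divisorStep m T) z (interval a (b ∸ a)) ≡ T a *ₚ z
foldr-divisorStep-segment {m} T z {a} {b} a<b a∣m none = begin
  foldr (divisorStep m T) z (interval a (b ∸ a))
    ≡⟨ cong (λ k → foldr (divisorStep m T) z (interval a k)) (ℕP.+-∸-assoc 1 {b} {suc a} a<b) ⟩
  divisorStep m T a (foldr (divisorStep m T) z (interval (suc a) (b ∸ suc a)))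
    ≡⟨ cong (divisorStep m T a) (foldr-divisorStep-none T z (suc a) (b ∸ suc a) λ a<d d<b →
         none a<d (ℕP.<-≤-trans d<b (ℕP.≤-reflexive (ℕP.m+[n∸m]≡n a<b)))) ⟩
  divisorStep m T a z
    ≡⟨ divisorStep-∣ T z a∣m ⟩
  T a *ₚ z ∎
  where open ≡-Reasoning

properDivProd-prime : ∀ {p} T → Prime p → properDivProd p T ≡ T 1 *ₚ [ 1ℤ ]
properDivProd-prime {p} T pp = trans (properDivProd-interval p T)
  (foldr-divisorStep-segment T [ 1ℤ ] (prime⇒>1 pp) (divides p (sym (ℕP.*-identityʳ p))) λ 1<d d<p d∣p →
    case prime⇒irreducible pp d∣p of λ where
      (inj₁ refl) → ℕP.<-irrefl refl 1<d
      (inj₂ refl) → ℕP.<-irrefl refl d<p)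

properDivProd-pq : ∀ {p q} T → Prime p → Prime q → p < q →
  properDivProd (p * q) T ≡ T 1 *ₚ (T p *ₚ (T q *ₚ [ 1ℤ ]))
properDivProd-pq {p} {q} T pp pq p<q = begin
  properDivProd n T
    ≡⟨ properDivProd-interval n T ⟩
  foldr step [ 1ℤ ] (interval 1 (n ∸ 1))
    ≡⟨ cong (foldr step [ 1ℤ ]) (interval-split (ℕP.<⇒≤ 1<p) p≤n) ⟩
  foldr step [ 1ℤ ] (interval 1 (p ∸ 1) ++ interval p (n ∸ p))
    ≡⟨ cong (λ l → foldr step [ 1ℤ ] (interval 1 (p ∸ 1) ++ l)) (interval-split (ℕP.<⇒≤ p<q) (ℕP.<⇒≤ q<n)) ⟩
  foldr step [ 1ℤ ] (interval 1 (p ∸ 1) ++ (interval p (q ∸ p) ++ interval q (n ∸ q)))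
    ≡⟨ ListP.foldr-++ step [ 1ℤ ] (interval 1 (p ∸ 1)) _ ⟩
  foldr step (foldr step [ 1ℤ ] (interval p (q ∸ p) ++ interval q (n ∸ q))) (interval 1 (p ∸ 1))
    ≡⟨ cong (λ z → foldr step z (interval 1 (p ∸ 1))) (ListP.foldr-++ step [ 1ℤ ] (interval p (q ∸ p)) _) ⟩
  foldr step (foldr step (foldr step [ 1ℤ ] (interval q (n ∸ q))) (interval p (q ∸ p))) (interval 1 (p ∸ 1))
    ≡⟨ cong (λ z → foldr step (foldr step z (interval p (q ∸ p))) (interval 1 (p ∸ 1)))
            (foldr-divisorStep-segment T _ q<n (divides p refl) between-q-n) ⟩
  foldr step (foldr step (T q *ₚ [ 1ℤ ]) (interval p (q ∸ p))) (interval 1 (p ∸ 1))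
    ≡⟨ cong (λ z → foldr step z (interval 1 (p ∸ 1)))
            (foldr-divisorStep-segment T _ p<q (divides q (ℕP.*-comm p q)) between-p-q) ⟩
  foldr step (T p *ₚ (T q *ₚ [ 1ℤ ])) (interval 1 (p ∸ 1))
    ≡⟨ foldr-divisorStep-segment T _ 1<p (divides n (sym (ℕP.*-identityʳ n))) between-1-p ⟩
  T 1 *ₚ (T p *ₚ (T q *ₚ [ 1ℤ ])) ∎
  where
  open ≡-Reasoning
  n = p * q
  step = divisorStep n T
  1<p = prime⇒>1 pp
  q<n = q<p*q pp pq
  p≤n : p ≤ n
  p≤n = ℕP.<⇒≤ (ℕP.<-trans p<q q<n)
  excluded : ∀ {d} → 1 < d → p ≢ d → q ≢ d → d < n → ¬ d ∣ n
  excluded {d} 1<d p≢d q≢d d<n d∣n = case divisors-of-pq pp pq d∣n of λ where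
    (inj₁ refl)               → ℕP.<-irrefl refl 1<d
    (inj₂ (inj₁ refl))        → p≢d refl
    (inj₂ (inj₂ (inj₁ refl))) → q≢d refl
    (inj₂ (inj₂ (inj₂ refl))) → ℕP.<-irrefl refl d<n
  between-1-p : ∀ {d} → 1 < d → d < p → ¬ d ∣ n
  between-1-p 1<d d<p = excluded 1<d (ℕP.>⇒≢ d<p) (ℕP.>⇒≢ (ℕP.<-trans d<p p<q)) (ℕP.<-trans (ℕP.<-trans d<p p<q) q<n)
  between-p-q : ∀ {d} → p < d → d < q → ¬ d ∣ n
  between-p-q p<d d<q = excluded (ℕP.<-trans 1<p p<d) (ℕP.<⇒≢ p<d) (ℕP.>⇒≢ d<q) (ℕP.<-trans d<q q<n)
  between-q-n : ∀ {d} → q < d → d < n → ¬ d ∣ n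
  between-q-n q<d d<n = excluded (ℕP.<-trans (ℕP.<-trans 1<p p<q) q<d) (ℕP.<⇒≢ (ℕP.<-trans p<q q<d)) (ℕP.<⇒≢ q<d) d<n

Φ-quot : ∀ {n} → 1 ≤ n → Φ n ≡ quotMonic (xⁿ-1 n) (properDivProd n (cycTab (n ∸ 1)))
Φ-quot {suc m} _ = Φ-unfold m

module _ {p} (pp : Prime p) where

  Φ-prime-quot : Φ p ≡ quotMonic (xⁿ-1 p) x-1
  -- The closed terms Φ 1 *ₚ [ 1ℤ ] and x-1 are equal by computation.
  Φ-prime-quot = trans (Φ-quot (ℕP.<⇒≤ (prime⇒>1 pp))) (cong (quotMonic (xⁿ-1 p))
    (trans (properDivProd-prime (cycTab (p ∸ 1)) pp) (cong (_*ₚ [ 1ℤ ]) (cycTab-Φ (p ∸ 1) ℕP.≤-refl 1≤p∸1))))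
    where 1≤p∸1 = ℕP.∸-monoˡ-≤ 1 (prime⇒>1 pp)

  Φ-prime≈repunit : Φ p ≈ repunit p
  Φ-prime≈repunit = subst (_≈ repunit p) (sym Φ-prime-quot) (quotMonic-exact monic-x-1 (x-1-*ₚ-repunit p))

  length-Φ-prime : length (Φ p) ≡ p
  length-Φ-prime = trans (cong length Φ-prime-quot) (trans (length-quotMonic (xⁿ-1 p) x-1) (cong (_∸ 1) (length-xⁿ-1 p)))

  monic-repunit-prime : Monic (p ∸ 1) (repunit p)
  monic-repunit-prime = subst (λ m → Monic (p ∸ 1) (repunit m)) (suc-prime∸1 pp) (monic-repunit (p ∸ 1))

  monic-Φ-prime : Monic (p ∸ 1) (Φ p)
  monic-Φ-prime = monic-cong (≈-sym Φ-prime≈repunit) monic-repunit-prime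

module _ {p q} (pp : Prime p) (pq : Prime q) (p<q : p < q) where

  private
    n = p * q
    1≤n : 1 ≤ n
    1≤n = ℕP.*-mono-≤ (ℕP.<⇒≤ (prime⇒>1 pp)) (ℕP.<⇒≤ (prime⇒>1 pq))

  Φ-pq-quot : Φ n ≡ quotMonic (xⁿ-1 n) (Φ 1 *ₚ (Φ p *ₚ (Φ q *ₚ [ 1ℤ ])))
  Φ-pq-quot = trans (Φ-quot 1≤n) (cong (quotMonic (xⁿ-1 n)) (trans (properDivProd-pq T pp pq p<q)
    (cong₂ (λ f g → f *ₚ g) (cycTab-Φ (n ∸ 1) ℕP.≤-refl 1≤n∸1)
      (cong₂ (λ f g → f *ₚ (g *ₚ [ 1ℤ ])) (cycTab-Φ (n ∸ 1) 1≤p p≤n∸1) (cycTab-Φ (n ∸ 1) 1≤q q≤n∸1)))))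
    where
    T = cycTab (n ∸ 1)
    1≤p = ℕP.<⇒≤ (prime⇒>1 pp)
    1≤q = ℕP.<⇒≤ (prime⇒>1 pq)
    q≤n∸1 : q ≤ n ∸ 1
    q≤n∸1 = ℕP.∸-monoˡ-≤ 1 (q<p*q pp pq)
    p≤n∸1 = ℕP.≤-trans (ℕP.<⇒≤ p<q) q≤n∸1
    1≤n∸1 = ℕP.≤-trans 1≤p p≤n∸1

  private
    inverse = modular-inverse {q} {p} (Coprime.sym (Coprime.prime⇒coprime pq {{prime⇒nonZero pp}} p<q)) (prime⇒>1 pq)
    a = proj₁ inverse
    b = proj₁ (proj₂ inverse)
    pa≡1+bq : p * a ≡ 1 + b * q
    pa≡1+bq = proj₂ (proj₂ (proj₂ (proj₂ inverse)))

    Y = geom p q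
    -- Φ (p q) in closed form, i.e. (x^n - 1)(x - 1) / ((x^p - 1)(x^q - 1)), written using pa = 1 + bq.
    E = geom p a *ₚ geom q p -ₚ shift 1 (geom q b *ₚ Y)

    xᵖ-1-*ₚ-Y : xⁿ-1 p *ₚ Y ≈ xⁿ-1 q *ₚ geom q p
    xᵖ-1-*ₚ-Y = ≈-trans (xⁿ-1-*ₚ-geom p q) (≈-trans (xⁿ-1-cong (ℕP.*-comm p q)) (≈-sym (xⁿ-1-*ₚ-geom q p)))

    -- x - 1 = (x^(pa) - 1) - x (x^(bq) - 1) lets x^q - 1 be pulled out of (x - 1) Y.
    x-1-*ₚ-Y : x-1 *ₚ Y ≈ xⁿ-1 q *ₚ E
    x-1-*ₚ-Y = begin
      x-1 *ₚ Y                                                      ≈⟨ *ₚ-congˡ Y (x-1-difference (b * q)) ⟩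
      (xⁿ-1 (suc (b * q)) -ₚ shift 1 (xⁿ-1 (b * q))) *ₚ Y            ≈⟨ *ₚ-distribʳ--ₚ (xⁿ-1 (suc (b * q))) (shift 1 (xⁿ-1 (b * q))) Y ⟩
      xⁿ-1 (suc (b * q)) *ₚ Y -ₚ shift 1 (xⁿ-1 (b * q)) *ₚ Y         ≈⟨ -ₚ-cong first second ⟩
      xⁿ-1 q *ₚ (geom p a *ₚ geom q p) -ₚ xⁿ-1 q *ₚ shift 1 (geom q b *ₚ Y) ≈⟨ *ₚ-distribˡ--ₚ (xⁿ-1 q) _ _ ⟨
      xⁿ-1 q *ₚ E                                                   ∎
      where
      open ≈-Reasoning
      first : xⁿ-1 (suc (b * q)) *ₚ Y ≈ xⁿ-1 q *ₚ (geom p a *ₚ geom q p)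
      first = begin
        xⁿ-1 (suc (b * q)) *ₚ Y                ≈⟨ *ₚ-congˡ Y (≈-trans (xⁿ-1-cong (sym pa≡1+bq)) (≈-sym (xⁿ-1-*ₚ-geom p a))) ⟩
        (xⁿ-1 p *ₚ geom p a) *ₚ Y              ≈⟨ solve 3 (λ x g y → (x ⊕ g) ⊕ y ⊜ g ⊕ (x ⊕ y)) ≈-refl (xⁿ-1 p) (geom p a) Y ⟩
        geom p a *ₚ (xⁿ-1 p *ₚ Y)              ≈⟨ *ₚ-congʳ (geom p a) xᵖ-1-*ₚ-Y ⟩
        geom p a *ₚ (xⁿ-1 q *ₚ geom q p)       ≈⟨ solve 3 (λ g x h → g ⊕ (x ⊕ h) ⊜ x ⊕ (g ⊕ h)) ≈-refl (geom p a) (xⁿ-1 q) (geom q p) ⟩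
        xⁿ-1 q *ₚ (geom p a *ₚ geom q p)       ∎
      second : shift 1 (xⁿ-1 (b * q)) *ₚ Y ≈ xⁿ-1 q *ₚ shift 1 (geom q b *ₚ Y)
      second = begin
        shift 1 (xⁿ-1 (b * q)) *ₚ Y            ≈⟨ shift-*ₚˡ 1 (xⁿ-1 (b * q)) Y ⟩
        shift 1 (xⁿ-1 (b * q) *ₚ Y)            ≈⟨ shift-cong 1 (*ₚ-congˡ Y (≈-trans (xⁿ-1-cong (ℕP.*-comm b q)) (≈-sym (xⁿ-1-*ₚ-geom q b)))) ⟩
        shift 1 ((xⁿ-1 q *ₚ geom q b) *ₚ Y)    ≈⟨ shift-cong 1 (*ₚ-assoc (xⁿ-1 q) (geom q b) Y) ⟩
        shift 1 (xⁿ-1 q *ₚ (geom q b *ₚ Y))    ≈⟨ shift-*ₚʳ 1 (xⁿ-1 q) _ ⟨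
        xⁿ-1 q *ₚ shift 1 (geom q b *ₚ Y)      ∎

    Y≈repunit-*ₚ-E : Y ≈ repunit q *ₚ E
    Y≈repunit-*ₚ-E = monic-*ₚ-cancelˡ monic-x-1 (begin
      x-1 *ₚ Y                    ≈⟨ x-1-*ₚ-Y ⟩
      xⁿ-1 q *ₚ E                 ≈⟨ *ₚ-congˡ E (x-1-*ₚ-repunit q) ⟨
      (x-1 *ₚ repunit q) *ₚ E     ≈⟨ *ₚ-assoc x-1 (repunit q) E ⟩
      x-1 *ₚ (repunit q *ₚ E)     ∎)
      where open ≈-Reasoning

    properΦ = Φ 1 *ₚ (Φ p *ₚ (Φ q *ₚ [ 1ℤ ]))

    properΦ≈ : properΦ ≈ x-1 *ₚ (repunit p *ₚ repunit q)
    properΦ≈ = *ₚ-congʳ x-1 (*ₚ-cong (Φ-prime≈repunit pp) (≈-trans (*ₚ-identityʳ (Φ q)) (Φ-prime≈repunit pq)))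

    properΦ-*ₚ-E : properΦ *ₚ E ≈ xⁿ-1 n
    properΦ-*ₚ-E = begin
      properΦ *ₚ E                                     ≈⟨ *ₚ-congˡ E properΦ≈ ⟩
      (x-1 *ₚ (repunit p *ₚ repunit q)) *ₚ E     ≈⟨ solve 4 (λ x s t e → (x ⊕ (s ⊕ t)) ⊕ e ⊜ (x ⊕ s) ⊕ (t ⊕ e)) ≈-refl x-1 (repunit p) (repunit q) E ⟩
      (x-1 *ₚ repunit p) *ₚ (repunit q *ₚ E)     ≈⟨ *ₚ-cong (x-1-*ₚ-repunit p) (≈-sym Y≈repunit-*ₚ-E) ⟩
      xⁿ-1 p *ₚ Y                                ≈⟨ xⁿ-1-*ₚ-geom p q ⟩
      xⁿ-1 n                                     ∎
      where open ≈-Reasoning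

    monic-properΦ : Monic (length properΦ ∸ 1) properΦ
    monic-properΦ = subst (λ d → Monic d properΦ) (cong (_∸ 1) (sym length-properΦ))
      (monic-*ₚ monic-x-1 (monic-*ₚ (monic-Φ-prime pp) (monic-*ₚ (monic-Φ-prime pq) monic-[1])))
      where
      length-properΦ : length properΦ ≡ suc (1 + ((p ∸ 1) + ((q ∸ 1) + 0)))
      length-properΦ = length-*ₚ 1 _ (Φ 1) (Φ p *ₚ (Φ q *ₚ [ 1ℤ ])) refl
        (length-*ₚ (p ∸ 1) _ (Φ p) (Φ q *ₚ [ 1ℤ ]) (trans (length-Φ-prime pp) (sym (suc-prime∸1 pp)))
          (length-*ₚ (q ∸ 1) 0 (Φ q) [ 1ℤ ] (trans (length-Φ-prime pq) (sym (suc-prime∸1 pq))) refl))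

    Φ-pq≈E : Φ n ≈ E
    Φ-pq≈E = subst (_≈ E) (sym Φ-pq-quot) (quotMonic-exact monic-properΦ properΦ-*ₚ-E)

  x-1-*ₚ-repunits-*ₚ-Φ-pq : (x-1 *ₚ (repunit p *ₚ repunit q)) *ₚ Φ n ≈ xⁿ-1 n
  x-1-*ₚ-repunits-*ₚ-Φ-pq = ≈-trans (*ₚ-cong (≈-sym properΦ≈) Φ-pq≈E) properΦ-*ₚ-E

  repunit-q-*ₚ-Φ-pq : repunit q *ₚ Φ n ≈ geom p q
  repunit-q-*ₚ-Φ-pq = ≈-trans (*ₚ-congʳ (repunit q) Φ-pq≈E) (≈-sym Y≈repunit-*ₚ-E)

  repunit-p-*ₚ-Φ-pq : repunit p *ₚ Φ n ≈ geom q p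
  repunit-p-*ₚ-Φ-pq = monic-*ₚ-cancelˡ (monic-*ₚ monic-x-1 (monic-repunit-prime pq)) (begin
    (x-1 *ₚ repunit q) *ₚ (repunit p *ₚ Φ n)   ≈⟨ solve 4 (λ x t s φ → (x ⊕ t) ⊕ (s ⊕ φ) ⊜ (x ⊕ (s ⊕ t)) ⊕ φ) ≈-refl x-1 (repunit q) (repunit p) (Φ n) ⟩
    (x-1 *ₚ (repunit p *ₚ repunit q)) *ₚ Φ n   ≈⟨ x-1-*ₚ-repunits-*ₚ-Φ-pq ⟩
    xⁿ-1 n                                     ≈⟨ xⁿ-1-cong (ℕP.*-comm p q) ⟩
    xⁿ-1 (q * p)                               ≈⟨ xⁿ-1-*ₚ-geom q p ⟨
    xⁿ-1 q *ₚ geom q p                         ≈⟨ *ₚ-congˡ (geom q p) (x-1-*ₚ-repunit q) ⟨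
    (x-1 *ₚ repunit q) *ₚ geom q p             ∎)
    where open ≈-Reasoning

  repunit-pq≈Φ-pq-*ₚ-repunits : repunit n ≈ Φ n *ₚ (repunit p *ₚ repunit q)
  repunit-pq≈Φ-pq-*ₚ-repunits = monic-*ₚ-cancelˡ monic-x-1 (begin
    x-1 *ₚ repunit n                           ≈⟨ x-1-*ₚ-repunit n ⟩
    xⁿ-1 n                                     ≈⟨ x-1-*ₚ-repunits-*ₚ-Φ-pq ⟨
    (x-1 *ₚ (repunit p *ₚ repunit q)) *ₚ Φ n   ≈⟨ solve 4 (λ x s t φ → (x ⊕ (s ⊕ t)) ⊕ φ ⊜ x ⊕ (φ ⊕ (s ⊕ t))) ≈-refl x-1 (repunit p) (repunit q) (Φ n) ⟩
    x-1 *ₚ (Φ n *ₚ (repunit p *ₚ repunit q))   ∎)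
    where open ≈-Reasoning

  Φ-pq-*ₚ-xⁿ-1-*ₚ-xⁿ-1 : ∀ a c → Φ n *ₚ (xⁿ-1 (q * a) *ₚ xⁿ-1 (p * c)) ≈ xⁿ-1 n *ₚ (x-1 *ₚ (geom q a *ₚ geom p c))
  Φ-pq-*ₚ-xⁿ-1-*ₚ-xⁿ-1 a c = begin
    Φ n *ₚ (xⁿ-1 (q * a) *ₚ xⁿ-1 (p * c))
      ≈⟨ *ₚ-congʳ (Φ n) (*ₚ-cong (factor q a) (factor p c)) ⟩
    Φ n *ₚ (((x-1 *ₚ repunit q) *ₚ geom q a) *ₚ ((x-1 *ₚ repunit p) *ₚ geom p c))
      ≈⟨ solve 6 (λ φ x t g s h → φ ⊕ (((x ⊕ t) ⊕ g) ⊕ ((x ⊕ s) ⊕ h)) ⊜ ((x ⊕ (s ⊕ t)) ⊕ φ) ⊕ (x ⊕ (g ⊕ h)))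
               ≈-refl (Φ n) x-1 (repunit q) (geom q a) (repunit p) (geom p c) ⟩
    ((x-1 *ₚ (repunit p *ₚ repunit q)) *ₚ Φ n) *ₚ (x-1 *ₚ (geom q a *ₚ geom p c))
      ≈⟨ *ₚ-congˡ _ x-1-*ₚ-repunits-*ₚ-Φ-pq ⟩
    xⁿ-1 n *ₚ (x-1 *ₚ (geom q a *ₚ geom p c))
      ∎
    where
    open ≈-Reasoning
    factor : ∀ r k → xⁿ-1 (r * k) ≈ (x-1 *ₚ repunit r) *ₚ geom r k
    factor r k = ≈-trans (≈-sym (xⁿ-1-*ₚ-geom r k)) (*ₚ-congˡ (geom r k) (≈-sym (x-1-*ₚ-repunit r)))

  Φ-pq-multiple-degree : ∀ {m f h} → Monic m f → NonpositiveExcept m f → f ≈ Φ n *ₚ h → n ∸ 1 ≤ m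
  Φ-pq-multiple-degree {m} {f} {h} mf nf f≈Φh with n ∸ 1 ℕ.≤? m | qa+pc≡1+pq pp pq p<q
  ... | yes n∸1≤m | _ = n∸1≤m
  ... | no  n∸1≰m | a , c , 1≤a , 1≤c , A+B≡1+n = ⊥-elim (xⁿ-1-∤-*ₚ-xᴬ-1-*ₚ-xᴮ-1 (h *ₚ V) 1+m<n 2≤A 2≤B A+B≡1+n mf nf (begin
    f *ₚ (xⁿ-1 (q * a) *ₚ xⁿ-1 (p * c))            ≈⟨ *ₚ-congˡ _ f≈Φh ⟩
    (Φ n *ₚ h) *ₚ (xⁿ-1 (q * a) *ₚ xⁿ-1 (p * c))   ≈⟨ solve 3 (λ φ h g → (φ ⊕ h) ⊕ g ⊜ h ⊕ (φ ⊕ g)) ≈-refl (Φ n) h _ ⟩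
    h *ₚ (Φ n *ₚ (xⁿ-1 (q * a) *ₚ xⁿ-1 (p * c)))   ≈⟨ *ₚ-congʳ h (Φ-pq-*ₚ-xⁿ-1-*ₚ-xⁿ-1 a c) ⟩
    h *ₚ (xⁿ-1 n *ₚ V)                             ≈⟨ solve 3 (λ h x v → h ⊕ (x ⊕ v) ⊜ x ⊕ (h ⊕ v)) ≈-refl h (xⁿ-1 n) V ⟩
    xⁿ-1 n *ₚ (h *ₚ V)                             ∎))
    where
    open ≈-Reasoning
    V = x-1 *ₚ (geom q a *ₚ geom p c)
    2≤A = ℕP.≤-trans (prime⇒>1 pq) (ℕP.≤-trans (ℕP.≤-reflexive (sym (ℕP.*-identityʳ q))) (ℕP.*-monoʳ-≤ q 1≤a))
    2≤B = ℕP.≤-trans (prime⇒>1 pp) (ℕP.≤-trans (ℕP.≤-reflexive (sym (ℕP.*-identityʳ p))) (ℕP.*-monoʳ-≤ p 1≤c))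

    1+m<n : suc m < n
    1+m<n = ℕP.<-≤-trans (s≤s (ℕP.≰⇒> n∸1≰m)) (ℕP.≤-reflexive (ℕP.m+[n∸m]≡n 1≤n))

  In𝒜-pq⇒≤deg : ∀ f → In𝒜 n f → n ∸ 1 ≤ deg f
  In𝒜-pq⇒≤deg f (suc k , bs , _ , _ , f≈fA , h , f≈Φh) =
    subst (n ∸ 1 ≤_) (sym (deg-monic mf)) (Φ-pq-multiple-degree mf nf (mk≈ f≈Φh))
    where
    fA≈f : fA (suc k) bs ≈ f
    fA≈f = ≈-sym (mk≈ f≈fA)
    mf = monic-cong fA≈f (monic-fA k bs)
    nf = nonpositiveExcept-cong fA≈f (fA-nonpositiveExcept k bs)

module _ {kp kq} (pp : Prime (suc kp)) (pq : Prime (suc kq)) (p<q : suc kp < suc kq) where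

  private
    p = suc kp
    q = suc kq
    n = p * q
    S₁ = spikes kq p
    S₂ = spikes kp q

  f⋆ : Poly
  f⋆ = (S₁ +ₚ S₂) -ₚ repunit n

  f⋆≈Φ-pq-*ₚ : f⋆ ≈ Φ n *ₚ ((shift kq (repunit p) +ₚ shift kp (repunit q)) -ₚ repunit p *ₚ repunit q)
  f⋆≈Φ-pq-*ₚ = begin
    (S₁ +ₚ S₂) -ₚ repunit n
      ≈⟨ -ₚ-cong (+ₚ-cong (shift-cong kq (≈-trans (≈-sym (repunit-p-*ₚ-Φ-pq pp pq p<q)) (*ₚ-comm (repunit p) (Φ n))))
                          (shift-cong kp (≈-trans (≈-sym (repunit-q-*ₚ-Φ-pq pp pq p<q)) (*ₚ-comm (repunit q) (Φ n)))))
                 (repunit-pq≈Φ-pq-*ₚ-repunits pp pq p<q) ⟩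
    (shift kq (Φ n *ₚ repunit p) +ₚ shift kp (Φ n *ₚ repunit q)) -ₚ Φ n *ₚ (repunit p *ₚ repunit q)
      ≈⟨ -ₚ-cong (+ₚ-cong (≈-sym (shift-*ₚʳ kq (Φ n) (repunit p))) (≈-sym (shift-*ₚʳ kp (Φ n) (repunit q)))) (≈-refl {Φ n *ₚ (repunit p *ₚ repunit q)}) ⟩
    (Φ n *ₚ shift kq (repunit p) +ₚ Φ n *ₚ shift kp (repunit q)) -ₚ Φ n *ₚ (repunit p *ₚ repunit q)
      ≈⟨ -ₚ-cong (≈-sym (*ₚ-distribˡ-+ₚ (Φ n) _ _)) (≈-refl {Φ n *ₚ (repunit p *ₚ repunit q)}) ⟩
    Φ n *ₚ (shift kq (repunit p) +ₚ shift kp (repunit q)) -ₚ Φ n *ₚ (repunit p *ₚ repunit q)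
      ≈⟨ *ₚ-distribˡ--ₚ (Φ n) _ _ ⟨
    Φ n *ₚ ((shift kq (repunit p) +ₚ shift kp (repunit q)) -ₚ repunit p *ₚ repunit q)
      ∎
    where open ≈-Reasoning

  private
    coeff-f⋆ : ∀ i {x y z} → coeff S₁ i ≡ x → coeff S₂ i ≡ y → coeff (repunit n) i ≡ z → coeff f⋆ i ≡ (x ℤ.+ y) ℤ.- z
    coeff-f⋆ i s₁ s₂ r =
      trans (coeff--ₚ (S₁ +ₚ S₂) (repunit n) i) (cong₂ ℤ._-_ (trans (coeff-+ₚ S₁ S₂ i) (cong₂ ℤ._+_ s₁ s₂)) r)

    repunit-below : ∀ {i} → suc i < n → coeff (repunit n) i ≡ 1ℤ
    repunit-below 1+i<n = coeff-repunit-< (ℕP.<-trans (ℕP.n<1+n _) 1+i<n)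

    no-spike-at-0 : ∀ {r t} → 1 < r → 1 ≢ r * suc t
    no-spike-at-0 {r} {t} 1<r e = ℕP.<-irrefl refl (ℕP.<-≤-trans 1<r (ℕP.≤-trans (ℕP.m≤m*n r (suc t)) (ℕP.≤-reflexive (sym e))))

    spike₁⇒ : ∀ {i t} → t < p → suc i ≡ q * suc t → suc i ≤ n
    spike₁⇒ {i} {t} t<p e = subst (suc i ≤_) (ℕP.*-comm q p) (subst (_≤ q * p) (sym e) (ℕP.*-monoʳ-≤ q t<p))

    spike₂⇒ : ∀ {i t} → t < q → suc i ≡ p * suc t → suc i ≤ n
    spike₂⇒ {i} {t} t<q e = subst (_≤ n) (sym e) (ℕP.*-monoʳ-≤ p t<q)

    spike₁∧spike₂⇒ : ∀ {i t t′} → t < p → suc i ≡ q * suc t → suc i ≡ p * suc t′ → suc i ≡ n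
    spike₁∧spike₂⇒ {i} {t} {t′} t<p e₁ e₂ = trans e₁ (trans (cong (q *_) 1+t≡p) (ℕP.*-comm q p))
      where
      p∣q[1+t] : p ∣ q * suc t
      p∣q[1+t] = divides (suc t′) (trans (sym e₁) (trans e₂ (ℕP.*-comm p (suc t′))))
      1+t≡p : suc t ≡ p
      1+t≡p = ℕP.≤-antisym t<p (∣⇒≤ (coprime-divisor (Coprime.sym (Coprime.prime⇒coprime pq {{prime⇒nonZero pp}} p<q)) p∣q[1+t]))

  coeff-f⋆-0 : coeff f⋆ 0 ≡ -1ℤ
  coeff-f⋆-0 with coeff-spikes kq p 0 | coeff-spikes kp q 0
  ... | inj₂ (_ , _ , e) | _               = ⊥-elim (no-spike-at-0 (prime⇒>1 pq) e)
  ... | inj₁ _           | inj₂ (_ , _ , e) = ⊥-elim (no-spike-at-0 (prime⇒>1 pp) e)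
  ... | inj₁ z₁           | inj₁ z₂           = coeff-f⋆ 0 z₁ z₂ (repunit-below (ℕP.≤-trans (prime⇒>1 pq) (ℕP.<⇒≤ (q<p*q pp pq))))

  coeff-f⋆-< : ∀ {i} → suc i < n → coeff f⋆ i ≡ +0 ⊎ coeff f⋆ i ≡ -1ℤ
  coeff-f⋆-< {i} 1+i<n with coeff-spikes kq p i | coeff-spikes kp q i
  ... | inj₂ (t , t<p , e₁) | inj₂ (_ , _ , e₂) = ⊥-elim (ℕP.<-irrefl (spike₁∧spike₂⇒ t<p e₁ e₂) 1+i<n)
  ... | inj₂ (t , t<p , e₁) | inj₁ z₂             = inj₁ (coeff-f⋆ i (coeff-spikes-at kq t<p e₁) z₂ (repunit-below 1+i<n))
  ... | inj₁ z₁             | inj₂ (t , t<q , e₂) = inj₁ (coeff-f⋆ i z₁ (coeff-spikes-at kp t<q e₂) (repunit-below 1+i<n))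
  ... | inj₁ z₁             | inj₁ z₂             = inj₂ (coeff-f⋆ i z₁ z₂ (repunit-below 1+i<n))

  coeff-f⋆-top : ∀ {i} → suc i ≡ n → coeff f⋆ i ≡ 1ℤ
  coeff-f⋆-top {i} 1+i≡n = coeff-f⋆ i (coeff-spikes-at kq (ℕP.n<1+n kp) (trans 1+i≡n (ℕP.*-comm p q)))
                                      (coeff-spikes-at kp (ℕP.n<1+n kq) 1+i≡n)
                                      (coeff-repunit-< (ℕP.≤-reflexive 1+i≡n))

  degreeBelow-f⋆ : DegreeBelow n f⋆
  degreeBelow-f⋆ = mkDegreeBelow vanishing
    where
    vanishing : ∀ i → n ≤ i → coeff f⋆ i ≡ +0
    vanishing i n≤i with coeff-spikes kq p i | coeff-spikes kp q i
    ... | inj₂ (t , t<p , e₁) | _                   = ⊥-elim (ℕP.<-irrefl refl (ℕP.<-≤-trans (spike₁⇒ t<p e₁) n≤i))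
    ... | inj₁ _              | inj₂ (t , t<q , e₂) = ⊥-elim (ℕP.<-irrefl refl (ℕP.<-≤-trans (spike₂⇒ t<q e₂) n≤i))
    ... | inj₁ z₁             | inj₁ z₂             = coeff-f⋆ i z₁ z₂ (vanish (degreeBelow-repunit n) i n≤i)

  private
    m′ = n ∸ 2
    2+m′≡n : suc (suc m′) ≡ n
    2+m′≡n = ℕP.m+[n∸m]≡n (ℕP.≤-trans (prime⇒>1 pq) (ℕP.<⇒≤ (q<p*q pp pq)))

  In𝒜-pq-witness : Σ[ f ∈ Poly ] (In𝒜 n f × deg f ≡ n ∸ 1)
  In𝒜-pq-witness with fA-realises m′ f⋆ coeff-f⋆-0 (coeff-f⋆-top 2+m′≡n)
                        (λ {i} i<m′ → coeff-f⋆-< (subst (suc (suc i) <_) 2+m′≡n (s≤s (s≤s i<m′))))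
                        (subst (λ k → DegreeBelow k f⋆) (sym 2+m′≡n) degreeBelow-f⋆)
  ... | bs , f⋆≈fA = fA (suc m′) bs
                   , (suc m′ , bs , s≤s z≤n , subst (suc m′ <_) 2+m′≡n ℕP.≤-refl , (λ _ → refl) ,
                      _ , at (≈-trans (≈-sym f⋆≈fA) f⋆≈Φ-pq-*ₚ))
                   , trans (deg-monic (monic-fA m′ bs)) (cong (_∸ 1) 2+m′≡n)

LeastDegreeIn𝒜 : ℕ → ℕ → Set
LeastDegreeIn𝒜 n d = (Σ[ f ∈ Poly ] (In𝒜 n f × deg f ≡ d)) × (∀ f → In𝒜 n f → d ≤ deg f)

leastDegreeIn𝒜-pq : ∀ {p q} → Prime p → Prime q → p < q → LeastDegreeIn𝒜 (p * q) (p * q ∸ 1)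
leastDegreeIn𝒜-pq {suc kp} {suc kq} pp pq p<q = In𝒜-pq-witness pp pq p<q , In𝒜-pq⇒≤deg pp pq p<q

theorem3p14 : (p₁ p₂ : ℕ) → Prime p₁ → Prime p₂ → p₁ ≢ p₂ →
    (Σ[ f ∈ Poly ] (In𝒜 (p₁ * p₂) f × deg f ≡ p₁ * p₂ ∸ 1))
    × (∀ f → In𝒜 (p₁ * p₂) f → p₁ * p₂ ∸ 1 ≤ deg f)
theorem3p14 p₁ p₂ pp₁ pp₂ p₁≢p₂ with ℕP.<-cmp p₁ p₂
... | tri< p₁<p₂ _ _ = leastDegreeIn𝒜-pq pp₁ pp₂ p₁<p₂
... | tri≈ _ p₁≡p₂ _ = ⊥-elim (p₁≢p₂ p₁≡p₂)
... | tri> _ _ p₂<p₁ = subst (λ n → LeastDegreeIn𝒜 n (n ∸ 1)) (ℕP.*-comm p₂ p₁) (leastDegreeIn𝒜-pq pp₂ pp₁ p₂<p₁)
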